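{- Let $q$ be any prime power, $n\ge 2$, $a\in\mathrm{GF}(q^2)^*$ and $b\in\mathrm{GF}(q^2)\setminus\mathrm{GF}(q)$, and assume one of the following holds: (i) $n$ and $q$ are odd and $4a^{q+1}+(b^q-b)^2\neq 0$; (ii) $n$ is even, $q$ is odd and $4a^{q+1}+(b^q-b)^2$ is a non-square in $\mathrm{GF}(q)$; (iii) $n$ and $q$ are even and $\mathrm{Tr}\big(a^{q+1}/(b^q+b)^2\big)=0$; (iv) $n$ is odd and $q$ is even. Let $\mathcal{W}=\{(x_0,\dots,x_n)\in\mathrm{GF}(q^2)^{n+1}: x_0=1,\ x_n\in\mathcal{C}\}$ and let $\mathcal{A}$ be the array with rows indexed by $x\in\mathcal{W}$ and columns indexed by $g\in\mathcal{R}$, whose $(x,g)$ entry is $F^g(x)$ (all entries lie in $T_0=\{t\in\mathrm{GF}(q^2):t+t^q=0\}$, a set of size $q$). Then $\mathcal{A}$ is a simple orthogonal array $OA(q^{2n-1},q^{2n-2},q,2)$ of index $\mu=q^{2n-3}$.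
   Context: $\mathrm{Tr}(x)=x+x^q$ for $x\in\mathrm{GF}(q^2)$. Let $F(X_0,\dots,X_n)=X_0^qX_n^q-X_nX_0^{2q-1}+a^q(X_1^{2q}+\dots+X_{n-1}^{2q})-a(X_1^2+\dots+X_{n-1}^2)X_0^{2q-2}-(b^q-b)(X_1^{q+1}+\dots+X_{n-1}^{q+1})X_0^{q-1}$. Let $\mathcal{C}$ be a transversal of $\mathrm{GF}(q)$ in the additive group of $\mathrm{GF}(q^2)$ (a set of coset representatives) containing $0$. Let $\mathcal{R}$ be the set of $(n+1)\times(n+1)$ matrices $M'$ whose first row is $(1,\alpha_1,\dots,\alpha_n)$ and whose remaining rows are those of the identity matrix, where $\alpha_1,\dots,\alpha_{n-1}\in\mathrm{GF}(q^2)$ are arbitrary and $\alpha_n$ is the unique element of $\mathcal{C}$ satisfying $\alpha_n^q-\alpha_n+a^q(\alpha_1^{2q}+\dots+\alpha_{n-1}^{2q})-a(\alpha_1^2+\dots+\alpha_{n-1}^2)=(b^q-b)(\alpha_1^{q+1}+\dots+\alpha_{n-1}^{q+1})$; $|\mathcal{R}|=q^{2n-2}$. For $g\in\mathcal{R}$ with matrix $M'$, $F^g(X)=F(XM')$ with $X$ a row vector. An orthogonal array $OA(N,k,v,t)$ is an $N\times k$ array with entries from a set of size $v$ such that in every $N\times t$ subarray each $t$-tuple of symbols appears exactly $N/v^t$ times ($N/v^t$ is the index); it is simple if it has no repeated rows. -}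

module Defs where

open import Level using (0ℓ)
open import Data.Nat as ℕ using (ℕ; zero; suc; _∸_; _<ᵇ_)
open import Data.Nat.Primality using (Prime)
open import Data.Nat.Divisibility using (_∣_)
open import Data.Fin using (Fin; toℕ)
open import Data.Bool using (Bool; true; false; if_then_else_; _∧_)
open import Data.List using (List; []; _∷_; length; filterᵇ; cartesianProductWith)
open import Data.List.Membership.Propositional using (_∈_)
open import Data.List.Relation.Unary.Unique.Propositional using (Unique)
open import Data.Vec.Functional as V using (Vector)
open import Data.Vec as Vec using (Vec; lookup)
open import Data.Product using (Σ; _×_; _,_; ∃)
open import Relation.Nullary using (¬_; does)
open import Relation.Binary.Definitions using (DecidableEquality)
open import Relation.Binary.PropositionalEquality using (_≡_; _≢_)
open import Algebra.Structures using (IsCommutativeRing)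

IsPrimePower : ℕ → Set
IsPrimePower q = Σ ℕ λ p → Σ ℕ λ e → Prime p × (e ℕ.≥ 1) × (q ≡ p ℕ.^ e)

-- A (concrete) finite field with exactly q² elements, i.e. a model of GF(q²).
-- Equality is propositional and decidable; the elements are listed
-- without repetition in `elems`.
record FiniteField (q : ℕ) : Set₁ where
  infix 4 _==_
  infixl 6 _+_ _-_
  infixl 7 _*_
  field
    K   : Set
    _+_ _*_ : K → K → K
    -_  : K → K
    0# 1# : K
    isCommutativeRing : IsCommutativeRing _≡_ _+_ _*_ -_ 0# 1#
    _⁻¹ : K → K
    ⁻¹-inverse : ∀ x → x ≢ 0# → x * (x ⁻¹) ≡ 1#
    0≢1 : 0# ≢ 1#
    _≟_ : DecidableEquality K
    elems : List K
    elems-unique : Unique elems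
    elems-complete : ∀ x → x ∈ elems
    elems-size : length elems ≡ q ℕ.* q

  _-_ : K → K → K
  x - y = x + (- y)

  _^_ : K → ℕ → K
  x ^ zero = 1#
  x ^ suc k = x * (x ^ k)

  _/_ : K → K → K
  x / y = x * (y ⁻¹)

  _==_ : K → K → Bool
  x == y = does (x ≟ y)

  -- GF(q) as the subfield of GF(q²) fixed by the Frobenius x ↦ x^q
  InGFq : K → Set
  InGFq x = x ^ q ≡ x

  Tr : K → K
  Tr x = x + x ^ q

  T₀ : List K
  T₀ = filterᵇ (λ t → Tr t == 0#) elems

  IsSquareInGFq : K → Set
  IsSquareInGFq c = Σ K λ y → InGFq y × (y * y ≡ c)

  four : K
  four = 1# + 1# + 1# + 1#

  Σ[_] : ∀ {m} → Vector K m → K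
  Σ[ v ] = V.foldr _+_ 0# v

  allVecs : (m : ℕ) → List (Vec K m)
  allVecs zero = Vec.[] ∷ []
  allVecs (suc m) = cartesianProductWith Vec._∷_ elems (allVecs m)

  midSum : (n : ℕ) → (K → K) → Vector K (suc n) → K
  midSum n f X = Σ[ (λ j → if (0 <ᵇ toℕ j) ∧ (toℕ j <ᵇ n) then f (X j) else 0#) ]

  F : (n : ℕ) → K → K → Vector K (suc n) → K
  F n a b X =
      (X₀ ^ q) * (Xₙ ^ q) - Xₙ * (X₀ ^ (2 ℕ.* q ∸ 1))
    + (a ^ q) * midSum n (λ x → x ^ (2 ℕ.* q)) X
    - a * midSum n (λ x → x ^ 2) X * (X₀ ^ (2 ℕ.* q ∸ 2))
    - ((b ^ q) - b) * midSum n (λ x → x ^ (q ℕ.+ 1)) X * (X₀ ^ (q ∸ 1))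
    where
      X₀ = X Data.Fin.zero
      Xₙ = X (Data.Fin.fromℕ n)

  IsTransversal : (K → Bool) → Set
  IsTransversal C =
      (C 0# ≡ true)
    × (∀ x → Σ K λ c → (C c ≡ true) × InGFq (x - c))
    × (∀ c c′ → C c ≡ true → C c′ ≡ true → InGFq (c - c′) → c ≡ c′)

  rowsW : (n : ℕ) → (K → Bool) → List (Vec K (suc n))
  rowsW n C = filterᵇ (λ x → (lookup x Data.Fin.zero == 1#) ∧ C (lookup x (Data.Fin.fromℕ n))) (allVecs (suc n))

  -- the vector (α₁,…,α_{n-1}) part and α_n, with α : Fin n → K, α i = α_{i+1}
  -- 𝒜-columns: α_n ∈ 𝒞 satisfies the defining equation
  colCond : (n : ℕ) → K → K → (K → Bool) → Vec K n → Bool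
  colCond zero a b C α = false
  colCond (suc m) a b C α =
    C αₙ ∧
      ((αₙ ^ q) - αₙ + (a ^ q) * Σ[ (λ i → lookup α (Data.Fin.inject₁ i) ^ (2 ℕ.* q)) ]
         - a * Σ[ (λ i → lookup α (Data.Fin.inject₁ i) ^ 2) ]
       == ((b ^ q) - b) * Σ[ (λ i → lookup α (Data.Fin.inject₁ i) ^ (q ℕ.+ 1)) ])
    where αₙ = lookup α (Data.Fin.fromℕ m)

  -- ℛ, each element represented by its first row (α₁,…,αₙ)
  colsR : (n : ℕ) → K → K → (K → Bool) → List (Vec K n)
  colsR n a b C = filterᵇ (colCond n a b C) (allVecs n)

  matrixM′ : ∀ {n} → Vec K n → Fin (suc n) → Fin (suc n) → K
  matrixM′ α Data.Fin.zero j = lookup (1# Vec.∷ α) j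
  matrixM′ α (Data.Fin.suc i) j = if does (Data.Fin._≟_ (Data.Fin.suc i) j) then 1# else 0#

  vecMat : ∀ {m} → Vector K m → (Fin m → Fin m → K) → Vector K m
  vecMat x M j = Σ[ (λ i → x i * M i j) ]

  Fᵍ : (n : ℕ) → K → K → Vec K n → Vec K (suc n) → K
  Fᵍ n a b α x = F n a b (vecMat (lookup x) (matrixM′ α))

  count : ∀ {A : Set} → (A → Bool) → List A → ℕ
  count p xs = length (filterᵇ p xs)

record IsOA₂ {R C S : Set} (_≟S_ : DecidableEquality S)
             (rows : List R) (cols : List C) (syms : List S)
             (A : R → C → S) (N k v μ : ℕ) : Set where
  field
    rows-size : length rows ≡ N
    cols-size : length cols ≡ k
    syms-unique : Unique syms
    syms-size : length syms ≡ v
    entries : ∀ r c → r ∈ rows → c ∈ cols → A r c ∈ syms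
    index : N ≡ μ ℕ.* (v ℕ.* v)
    balanced : ∀ c c′ → c ∈ cols → c′ ∈ cols → c ≢ c′ →
               ∀ s t → s ∈ syms → t ∈ syms →
               length (filterᵇ (λ r → does (A r c ≟S s) ∧ does (A r c′ ≟S t)) rows) ≡ μ

IsSimple : {R C S : Set} (rows : List R) (cols : List C) (A : R → C → S) → Set
IsSimple rows cols A =
  Unique rows × (∀ r r′ → r ∈ rows → r′ ∈ rows → (∀ c → c ∈ cols → A r c ≡ A r′ c) → r ≡ r′)

{-# OPTIONS --safe #-}

-- Write a row as x = (1, y, xₙ) with xₙ ∈ 𝒞 and a column as (α, αₙ). Since
-- x M′ = (1, α + y, αₙ + xₙ), the entry is φ (αₙ + xₙ) + Σᵢ Q (αᵢ + yᵢ), where φ z = z^q − z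
-- and Q u = a^q u^(2q) − a u² − (b^q − b) u^(q+1); both φ and Q take values in T₀.
-- T₀ and GF(q) are root sets of x^q + x and x^q − x, so each has at most q elements;
-- φ embeds 𝒞 into T₀ (its kernel is GF(q)) and |𝒞| |GF(q)| = q², so all three have exactly
-- q elements and φ : 𝒞 → T₀ is a bijection.  Hence, for fixed y, a prescribed entry in one
-- column is attained by exactly one xₙ, and the entries of columns α, β then differ by
-- Σᵢ [Q (αᵢ + yᵢ) − Q (βᵢ + yᵢ)].  Polarising, Q (α + y) − Q (β + y) = φ (w (α − β) y) + const
-- with w d = 2 a d + (b^q − b) d^q, which is injective as soon as 4 a^(q+1) + (b^q − b)² ≠ 0;
-- so each coordinate with αᵢ ≠ βᵢ takes every value of T₀ exactly q times, and the index is
-- q^(2n−3).  Each of (i)–(iv) gives that discriminant condition.  For simplicity: rows with equal entries in every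
-- column make a ↦ φ (w (y₀ − y₀′) a) constant, hence zero, which is impossible when
-- w (y₀ − y₀′) ≠ 0 because φ b ≠ 0.
module Submission where

open import Defs
open import Data.Nat using (ℕ; _≥_; _∸_)
open import Data.Nat.Divisibility using (_∣_)
open import Data.Bool using (Bool)
open import Data.Product using (_×_)
open import Data.Sum using (_⊎_)
open import Relation.Nullary using (¬_)
open import Relation.Binary.PropositionalEquality using (_≡_; _≢_)

open import Level using (0ℓ)
open import Algebra.Bundles using (CommutativeRing; CommutativeSemiring)
open import Algebra.Solver.Ring.AlmostCommutativeRing using (fromCommutativeRing; _-Raw-AlmostCommutative⟶_)
import Algebra.Solver.Ring
open import Data.Bool using (true; false; _∧_; not; if_then_else_; T?)
open import Data.Bool.Properties using (T-≡; ∧-assoc; ∧-idem; ∧-identityʳ)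
open import Data.Empty using (⊥-elim)
open import Data.Fin as Fin using (Fin; toℕ; fromℕ; inject₁)
import Data.Fin.Properties as Fin
import Data.Integer as ℤ
open import Data.List using (List; []; _∷_; length; filterᵇ; map; foldr; replicate; _++_; cartesianProductWith; cartesianProduct)
open import Data.List.Properties using (length-++; length-map; length-replicate)
open import Data.List.Membership.Propositional using (_∈_; _∉_)
open import Data.List.Membership.Propositional.Properties
  using (∈-filter⁺; ∈-filter⁻; ∈-map⁺; ∈-map⁻; ∈-cartesianProductWith⁺; ∈-cartesianProduct⁺; ∈-cartesianProduct⁻)
open import Data.List.Relation.Unary.Any using (here; there)
open import Data.List.Relation.Unary.All as All using (All; []; _∷_)
open import Data.List.Relation.Unary.Unique.Propositional using (Unique; []; _∷_)
import Data.List.Relation.Unary.Unique.Propositional.Properties as Unique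
open import Data.List.Relation.Binary.Permutation.Propositional as Perm using (_↭_; ↭-refl; ↭-trans; ↭-sym; ↭-prep; ↭⇒↭ₛ)
open import Data.List.Relation.Binary.Permutation.Propositional.Properties using (↭-length; filter-↭)
import Data.List.Relation.Binary.Permutation.Setoid.Properties as PermutationSetoid
open import Data.Maybe using (Maybe; just; nothing)
open import Data.Nat as ℕ using (zero; suc; _≤_; _<_; z≤n; s≤s; _!; _<ᵇ_)
import Data.Nat.Properties as ℕ
open import Data.Nat.Combinatorics using (nCk≡n!/k![n-k]!; k![n∸k]!∣n!; nCn≡1) renaming (_C_ to _choose_)
open import Data.Nat.DivMod using (m/n*n≡m)
open import Data.Nat.Divisibility using (divides; ∣1⇒≡1; ∣⇒≤; m∣m*n)
open import Data.Nat.Primality using (Prime; euclidsLemma; ¬prime[0]; ¬prime[1]; prime[2]; prime⇒irreducible)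
open import Data.Product using (Σ; _,_; proj₁; proj₂; uncurry)
open import Data.Sum using (inj₁; inj₂; [_,_]′)
open import Data.Vec as Vec using (Vec; []; _∷_; lookup; _∷ʳ_; initLast)
import Data.Vec.Properties as Vec
open import Data.Vec.Functional using (Vector)
open import Function using (_∘_; Equivalence)
open import Relation.Nullary using (yes; no; does)
open import Relation.Binary.Definitions using (DecidableEquality)
open import Relation.Binary.PropositionalEquality using (refl; sym; trans; cong; cong₂; subst; module ≡-Reasoning)
import Relation.Binary.PropositionalEquality as ≡

-- Ring normalisation with integer coefficients

module IntegerCoefficientSolver {c ℓ} (R : CommutativeRing c ℓ) where

  open import Data.Integer using (ℤ; +_; -[1+_])
  import Data.Integer.Properties as ℤ
  open import Data.Sign as Sign using (Sign)

  open CommutativeRing R renaming (refl to ≈-refl; sym to ≈-sym; trans to ≈-trans)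
  open import Algebra.Properties.Ring ring
    using (-0#≈0#; -‿involutive; -‿distribˡ-*; -‿distribʳ-*; -‿anti-homo-+)
  open import Algebra.Properties.Semiring.Mult.TCOptimised semiring using (×1-homo-*) renaming (_×_ to _·_)
  open import Algebra.Properties.Monoid.Mult.TCOptimised +-monoid using (×-homo-+)
  open import Relation.Binary.Reasoning.Setoid setoid

  private
    -‿distrib-+ : ∀ x y → - (x + y) ≈ - x + - y
    -‿distrib-+ x y = ≈-trans (-‿anti-homo-+ x y) (+-comm (- y) (- x))

  -- The TCOptimised multiple makes 1 · 1# reduce to 1# and 2 · 1# to 1# + 1#, so the
  -- constants of solver expressions agree definitionally with the ring's own.
  ⟦_⟧ℤ : ℤ → Carrier
  ⟦ + n ⟧ℤ = n · 1#
  ⟦ -[1+ n ] ⟧ℤ = - (suc n · 1#)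

  ⟦⊖⟧ : ∀ m n → ⟦ m ℤ.⊖ n ⟧ℤ ≈ m · 1# - n · 1#
  ⟦⊖⟧ m zero = ≈-sym (≈-trans (+-congˡ -0#≈0#) (+-identityʳ _))
  ⟦⊖⟧ zero (suc n) = ≈-sym (+-identityˡ _)
  ⟦⊖⟧ (suc m) (suc n) = begin
    ⟦ suc m ℤ.⊖ suc n ⟧ℤ          ≡⟨ cong ⟦_⟧ℤ (ℤ.[1+m]⊖[1+n]≡m⊖n m n) ⟩
    ⟦ m ℤ.⊖ n ⟧ℤ                  ≈⟨ ⟦⊖⟧ m n ⟩
    m · 1# - n · 1#               ≈⟨ cancel-1# (m · 1#) (n · 1#) ⟨
    (1# + m · 1#) - (1# + n · 1#) ≈⟨ +-congˡ (-‿cong (×-homo-+ 1# 1 n)) ⟨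
    (1# + m · 1#) - suc n · 1#    ≈⟨ +-congʳ (×-homo-+ 1# 1 m) ⟨
    suc m · 1# - suc n · 1#       ∎
    where
    cancel-1# : ∀ a b → (1# + a) - (1# + b) ≈ a - b
    cancel-1# a b = begin
      (1# + a) + - (1# + b)     ≈⟨ +-cong (+-comm 1# a) (-‿distrib-+ 1# b) ⟩
      (a + 1#) + (- 1# + - b)   ≈⟨ +-assoc a 1# _ ⟩
      a + (1# + (- 1# + - b))   ≈⟨ +-congˡ (+-assoc 1# (- 1#) (- b)) ⟨
      a + ((1# + - 1#) + - b)   ≈⟨ +-congˡ (+-congʳ (-‿inverseʳ 1#)) ⟩
      a + (0# + - b)            ≈⟨ +-congˡ (+-identityˡ (- b)) ⟩
      a + - b                   ∎

  ⟦+⟧ : ∀ i j → ⟦ i ℤ.+ j ⟧ℤ ≈ ⟦ i ⟧ℤ + ⟦ j ⟧ℤ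
  ⟦+⟧ (+ m) (+ n) = ×-homo-+ 1# m n
  ⟦+⟧ (+ m) -[1+ n ] = ⟦⊖⟧ m (suc n)
  ⟦+⟧ -[1+ m ] (+ n) = ≈-trans (⟦⊖⟧ n (suc m)) (+-comm _ _)
  ⟦+⟧ -[1+ m ] -[1+ n ] = begin
    - (suc (suc (m ℕ.+ n)) · 1#)          ≡⟨ cong (λ k → - (suc k · 1#)) (ℕ.+-suc m n) ⟨
    - ((suc m ℕ.+ suc n) · 1#)            ≈⟨ -‿cong (×-homo-+ 1# (suc m) (suc n)) ⟩
    - (suc m · 1# + suc n · 1#)           ≈⟨ -‿distrib-+ _ _ ⟩
    - (suc m · 1#) + - (suc n · 1#)       ∎

  private
    signed : Sign → Carrier → Carrier
    signed Sign.+ x = x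
    signed Sign.- x = - x

    ⟦◃⟧ : ∀ s n → ⟦ s ℤ.◃ n ⟧ℤ ≈ signed s (n · 1#)
    ⟦◃⟧ Sign.+ zero = ≈-refl
    ⟦◃⟧ Sign.- zero = ≈-sym -0#≈0#
    ⟦◃⟧ Sign.+ (suc n) = ≈-refl
    ⟦◃⟧ Sign.- (suc n) = ≈-refl

    ⟦⟧-sign-abs : ∀ i → ⟦ i ⟧ℤ ≈ signed (ℤ.sign i) (ℤ.∣ i ∣ · 1#)
    ⟦⟧-sign-abs (+ n) = ≈-refl
    ⟦⟧-sign-abs -[1+ n ] = ≈-refl

    signed-cong : ∀ s {x y} → x ≈ y → signed s x ≈ signed s y
    signed-cong Sign.+ x≈y = x≈y
    signed-cong Sign.- x≈y = -‿cong x≈y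

    signed-* : ∀ s t x y → signed (s Sign.* t) (x * y) ≈ signed s x * signed t y
    signed-* Sign.+ Sign.+ x y = ≈-refl
    signed-* Sign.+ Sign.- x y = -‿distribʳ-* x y
    signed-* Sign.- Sign.+ x y = -‿distribˡ-* x y
    signed-* Sign.- Sign.- x y = begin
      x * y         ≈⟨ -‿involutive _ ⟨
      - (- (x * y)) ≈⟨ -‿cong (-‿distribˡ-* x y) ⟩
      - (- x * y)   ≈⟨ -‿distribʳ-* (- x) y ⟩
      - x * - y     ∎

  ⟦*⟧ : ∀ i j → ⟦ i ℤ.* j ⟧ℤ ≈ ⟦ i ⟧ℤ * ⟦ j ⟧ℤ
  ⟦*⟧ i j = begin
    ⟦ (s Sign.* t) ℤ.◃ (ℤ.∣ i ∣ ℕ.* ℤ.∣ j ∣) ⟧ℤ           ≈⟨ ⟦◃⟧ (s Sign.* t) (ℤ.∣ i ∣ ℕ.* ℤ.∣ j ∣) ⟩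
    signed (s Sign.* t) ((ℤ.∣ i ∣ ℕ.* ℤ.∣ j ∣) · 1#)     ≈⟨ signed-cong (s Sign.* t) (×1-homo-* ℤ.∣ i ∣ ℤ.∣ j ∣) ⟩
    signed (s Sign.* t) ((ℤ.∣ i ∣ · 1#) * (ℤ.∣ j ∣ · 1#)) ≈⟨ signed-* s t _ _ ⟩
    signed s (ℤ.∣ i ∣ · 1#) * signed t (ℤ.∣ j ∣ · 1#)   ≈⟨ *-cong (⟦⟧-sign-abs i) (⟦⟧-sign-abs j) ⟨
    ⟦ i ⟧ℤ * ⟦ j ⟧ℤ                                      ∎
    where
    s = ℤ.sign i
    t = ℤ.sign j

  ⟦-⟧ : ∀ i → ⟦ ℤ.- i ⟧ℤ ≈ - ⟦ i ⟧ℤ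
  ⟦-⟧ -[1+ n ] = ≈-sym (-‿involutive _)
  ⟦-⟧ (+ zero) = ≈-sym -0#≈0#
  ⟦-⟧ (+ suc n) = ≈-refl

  ⟦⟧-homomorphism : ℤ.+-*-rawRing -Raw-AlmostCommutative⟶ fromCommutativeRing R
  ⟦⟧-homomorphism = record
    { ⟦_⟧ = ⟦_⟧ℤ ; +-homo = ⟦+⟧ ; *-homo = ⟦*⟧ ; -‿homo = ⟦-⟧ ; 0-homo = ≈-refl ; 1-homo = ≈-refl }

  private
    ⟦⟧-≟ : ∀ i j → Maybe (⟦ i ⟧ℤ ≈ ⟦ j ⟧ℤ)
    ⟦⟧-≟ i j with i ℤ.≟ j
    ... | yes refl = just ≈-refl
    ... | no _ = nothing

  open Algebra.Solver.Ring ℤ.+-*-rawRing (fromCommutativeRing R) ⟦⟧-homomorphism ⟦⟧-≟ public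
    using (solve; _:=_; _:+_; _:*_; _:-_; :-_; con)

-- Counting in lists

module _ {A : Set} where

  All≢⇒∉ : ∀ {x : A} {xs} → All (x ≢_) xs → x ∉ xs
  All≢⇒∉ (x≢y ∷ _) (here x≡y) = x≢y x≡y
  All≢⇒∉ (_ ∷ x≢xs) (there x∈) = All≢⇒∉ x≢xs x∈

  count : (A → Bool) → List A → ℕ
  count p xs = length (filterᵇ p xs)

  ∈-filterᵇ⁺ : ∀ (p : A → Bool) {x xs} → x ∈ xs → p x ≡ true → x ∈ filterᵇ p xs
  ∈-filterᵇ⁺ p x∈xs px = ∈-filter⁺ (T? ∘ p) x∈xs (Equivalence.from T-≡ px)

  ∈-filterᵇ⁻ : ∀ (p : A → Bool) {x xs} → x ∈ filterᵇ p xs → x ∈ xs × p x ≡ true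
  ∈-filterᵇ⁻ p x∈ with ∈-filter⁻ (T? ∘ p) x∈
  ... | x∈xs , px = x∈xs , Equivalence.to T-≡ px

  Unique-filterᵇ : ∀ (p : A → Bool) {xs} → Unique xs → Unique (filterᵇ p xs)
  Unique-filterᵇ p = Unique.filter⁺ (T? ∘ p)

  filterᵇ-filterᵇ : ∀ (p r : A → Bool) xs → filterᵇ p (filterᵇ r xs) ≡ filterᵇ (λ x → r x ∧ p x) xs
  filterᵇ-filterᵇ p r [] = refl
  filterᵇ-filterᵇ p r (x ∷ xs) with r x
  ... | false = filterᵇ-filterᵇ p r xs
  ... | true with p x
  ...   | true = cong (x ∷_) (filterᵇ-filterᵇ p r xs)
  ...   | false = filterᵇ-filterᵇ p r xs

  sumBy : (A → ℕ) → List A → ℕ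
  sumBy f [] = 0
  sumBy f (x ∷ xs) = f x ℕ.+ sumBy f xs

  sumBy-cong : ∀ {f g} xs → (∀ x → x ∈ xs → f x ≡ g x) → sumBy f xs ≡ sumBy g xs
  sumBy-cong [] f≗g = refl
  sumBy-cong (x ∷ xs) f≗g = cong₂ ℕ._+_ (f≗g x (here refl)) (sumBy-cong xs (λ y y∈ → f≗g y (there y∈)))

  sumBy-const : ∀ k xs → sumBy (λ _ → k) xs ≡ length xs ℕ.* k
  sumBy-const k [] = refl
  sumBy-const k (x ∷ xs) = cong (k ℕ.+_) (sumBy-const k xs)

  sumBy-++ : ∀ f xs ys → sumBy f (xs ++ ys) ≡ sumBy f xs ℕ.+ sumBy f ys
  sumBy-++ f [] ys = refl
  sumBy-++ f (x ∷ xs) ys = trans (cong (f x ℕ.+_) (sumBy-++ f xs ys)) (sym (ℕ.+-assoc (f x) _ _))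

  sumBy-if : ∀ p k xs → sumBy (λ x → if p x then k else 0) xs ≡ count p xs ℕ.* k
  sumBy-if p k [] = refl
  sumBy-if p k (x ∷ xs) with p x
  ... | true = cong (k ℕ.+_) (sumBy-if p k xs)
  ... | false = sumBy-if p k xs

  count-cong : ∀ {p r} xs → (∀ x → x ∈ xs → p x ≡ r x) → count p xs ≡ count r xs
  count-cong [] p≗r = refl
  count-cong {p} {r} (x ∷ xs) p≗r with p x | r x | p≗r x (here refl)
  ... | true | true | _ = cong suc (count-cong xs (λ y y∈ → p≗r y (there y∈)))
  ... | false | false | _ = count-cong xs (λ y y∈ → p≗r y (there y∈))

  count-const : ∀ b xs → count (λ _ → b) xs ≡ (if b then length xs else 0)
  count-const true [] = refl
  count-const true (x ∷ xs) = cong suc (count-const true xs)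
  count-const false xs = count-const-false xs
    where
    count-const-false : ∀ xs → count (λ _ → false) xs ≡ 0
    count-const-false [] = refl
    count-const-false (_ ∷ xs) = count-const-false xs

  count-[] : ∀ p x → count p (x ∷ []) ≡ (if p x then 1 else 0)
  count-[] p x with p x
  ... | true = refl
  ... | false = refl

  count-false : ∀ p xs → (∀ x → x ∈ xs → p x ≡ false) → count p xs ≡ 0
  count-false p xs p≡false = trans (count-cong xs p≡false) (count-const false xs)

  count-++ : ∀ p xs ys → count p (xs ++ ys) ≡ count p xs ℕ.+ count p ys
  count-++ p [] ys = refl
  count-++ p (x ∷ xs) ys with p x
  ... | true = cong suc (count-++ p xs ys)
  ... | false = count-++ p xs ys

  length≡count+count-not : ∀ p xs → length xs ≡ count p xs ℕ.+ count (not ∘ p) xs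
  length≡count+count-not p [] = refl
  length≡count+count-not p (x ∷ xs) with p x
  ... | true = cong suc (length≡count+count-not p xs)
  ... | false = trans (cong suc (length≡count+count-not p xs)) (sym (ℕ.+-suc _ _))

  count-↭ : ∀ p {xs ys} → xs ↭ ys → count p xs ≡ count p ys
  count-↭ p xs↭ys = ↭-length (filter-↭ (T? ∘ p) xs↭ys)

  sumBy-single : ∀ g c xs → Unique xs → c ∈ xs → (∀ x → x ∈ xs → x ≢ c → g x ≡ 0) → sumBy g xs ≡ g c
  sumBy-single g c (x ∷ xs) (x∉xs ∷ _) (here refl) g≡0 =
    trans (cong (g x ℕ.+_) (trans (sumBy-cong xs (λ y y∈ → g≡0 y (there y∈) (λ { refl → All≢⇒∉ x∉xs y∈ })))
                                  (trans (sumBy-const 0 xs) (ℕ.*-zeroʳ (length xs)))))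
          (ℕ.+-identityʳ _)
  sumBy-single g c (x ∷ xs) (x∉xs ∷ u) (there c∈) g≡0 =
    trans (cong (ℕ._+ sumBy g xs) (g≡0 x (here refl) (λ { refl → All≢⇒∉ x∉xs c∈ })))
          (sumBy-single g c xs u c∈ (λ y y∈ → g≡0 y (there y∈)))

module _ {A B : Set} where

  count-map : ∀ (p : B → Bool) (f : A → B) xs → count p (map f xs) ≡ count (p ∘ f) xs
  count-map p f [] = refl
  count-map p f (x ∷ xs) with p (f x)
  ... | true = cong suc (count-map p f xs)
  ... | false = count-map p f xs

  sumBy-map : ∀ (g : B → ℕ) (f : A → B) xs → sumBy g (map f xs) ≡ sumBy (g ∘ f) xs
  sumBy-map g f [] = refl
  sumBy-map g f (x ∷ xs) = cong (g (f x) ℕ.+_) (sumBy-map g f xs)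

  Unique-map⁺ : ∀ (f : A → B) {xs} → Unique xs → (∀ {x y} → x ∈ xs → y ∈ xs → f x ≡ f y → x ≡ y) → Unique (map f xs)
  Unique-map⁺ f [] inj = []
  Unique-map⁺ f (x∉xs ∷ u) inj =
    All.tabulate (λ {z} z∈ fx≡z → let y , y∈ , z≡fy = ∈-map⁻ f z∈ in
                   All.lookup x∉xs y∈ (inj (here refl) (there y∈) (trans fx≡z z≡fy)))
    ∷ Unique-map⁺ f u (λ x∈ y∈ → inj (there x∈) (there y∈))

module _ {A B C : Set} (f : A → B → C) where

  count-cartesianProductWith : ∀ (p : C → Bool) xs ys →
    count p (cartesianProductWith f xs ys) ≡ sumBy (λ x → count (λ y → p (f x y)) ys) xs
  count-cartesianProductWith p [] ys = refl
  count-cartesianProductWith p (x ∷ xs) ys =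
    trans (count-++ p (map (f x) ys) _) (cong₂ ℕ._+_ (count-map p (f x) ys) (count-cartesianProductWith p xs ys))

  sumBy-cartesianProductWith : ∀ (g : C → ℕ) xs ys →
    sumBy g (cartesianProductWith f xs ys) ≡ sumBy (λ x → sumBy (λ y → g (f x y)) ys) xs
  sumBy-cartesianProductWith g [] ys = refl
  sumBy-cartesianProductWith g (x ∷ xs) ys =
    trans (sumBy-++ g (map (f x) ys) _) (cong₂ ℕ._+_ (sumBy-map g (f x) ys) (sumBy-cartesianProductWith g xs ys))

  length-cartesianProductWith : ∀ xs ys → length (cartesianProductWith f xs ys) ≡ length xs ℕ.* length ys
  length-cartesianProductWith [] ys = refl
  length-cartesianProductWith (x ∷ xs) ys =
    trans (length-++ (map (f x) ys)) (cong₂ ℕ._+_ (length-map (f x) ys) (length-cartesianProductWith xs ys))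

module WithDecidableEquality {A : Set} (_≟_ : DecidableEquality A) where

  open import Data.List.Membership.DecPropositional _≟_ using (_∈?_)

  private
    remove : ∀ {x : A} xs → x ∈ xs → List A
    remove (y ∷ xs) (here _) = xs
    remove (y ∷ xs) (there x∈) = y ∷ remove xs x∈

    remove-↭ : ∀ {x : A} xs (x∈ : x ∈ xs) → xs ↭ x ∷ remove xs x∈
    remove-↭ (y ∷ xs) (here refl) = ↭-refl
    remove-↭ (y ∷ xs) (there x∈) = ↭-trans (↭-prep y (remove-↭ xs x∈)) (Perm.swap y _ ↭-refl)

    ∈-remove⁺ : ∀ {x y : A} xs (x∈ : x ∈ xs) → y ∈ xs → y ≢ x → y ∈ remove xs x∈
    ∈-remove⁺ (z ∷ xs) (here refl) (here refl) y≢x = ⊥-elim (y≢x refl)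
    ∈-remove⁺ (z ∷ xs) (here refl) (there y∈) y≢x = y∈
    ∈-remove⁺ (z ∷ xs) (there x∈) (here refl) y≢x = here refl
    ∈-remove⁺ (z ∷ xs) (there x∈) (there y∈) y≢x = there (∈-remove⁺ xs x∈ y∈ y≢x)

    ∈-remove⁻ : ∀ {x y : A} xs (x∈ : x ∈ xs) → y ∈ remove xs x∈ → y ∈ xs
    ∈-remove⁻ (z ∷ xs) (here refl) y∈ = there y∈
    ∈-remove⁻ (z ∷ xs) (there x∈) (here refl) = here refl
    ∈-remove⁻ (z ∷ xs) (there x∈) (there y∈) = there (∈-remove⁻ xs x∈ y∈)

    Unique-remove : ∀ {x : A} xs (x∈ : x ∈ xs) → Unique xs → Unique (remove xs x∈)
    Unique-remove (y ∷ xs) (here refl) (_ ∷ u) = u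
    Unique-remove (y ∷ xs) (there x∈) (y∉ ∷ u) =
      All.tabulate (λ z∈ → All.lookup y∉ (∈-remove⁻ xs x∈ z∈)) ∷ Unique-remove xs x∈ u

    ∉-remove : ∀ {x : A} xs (x∈ : x ∈ xs) → Unique xs → x ∉ remove xs x∈
    ∉-remove (y ∷ xs) (here refl) (y∉ ∷ _) x∈′ = All≢⇒∉ y∉ x∈′
    ∉-remove (y ∷ xs) (there x∈) (y∉ ∷ _) (here refl) = All≢⇒∉ y∉ x∈
    ∉-remove (y ∷ xs) (there x∈) (_ ∷ u) (there x∈′) = ∉-remove xs x∈ u x∈′

  Unique-⊆⇒length≤ : ∀ {xs ys : List A} → Unique xs → (∀ {x} → x ∈ xs → x ∈ ys) → length xs ≤ length ys
  Unique-⊆⇒length≤ {[]} _ _ = z≤n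
  Unique-⊆⇒length≤ {x ∷ xs} {ys} (x∉xs ∷ u) xs⊆ys =
    subst (suc (length xs) ≤_) (sym (↭-length (remove-↭ ys x∈ys)))
      (s≤s (Unique-⊆⇒length≤ u (λ z∈ → ∈-remove⁺ ys x∈ys (xs⊆ys (there z∈)) (λ { refl → All≢⇒∉ x∉xs z∈ }))))
    where x∈ys = xs⊆ys (here refl)

  Unique-⊆-length≥⇒⊇ : ∀ {xs ys : List A} → Unique xs → (∀ {x} → x ∈ xs → x ∈ ys) →
                        length ys ≤ length xs → ∀ {y} → y ∈ ys → y ∈ xs
  Unique-⊆-length≥⇒⊇ {xs} {ys} u xs⊆ys ys≤xs {y} y∈ys with y ∈? xs
  ... | yes y∈xs = y∈xs
  ... | no y∉xs = ⊥-elim (ℕ.<⇒≱ (Unique-⊆⇒length≤ (y∉xs′ ∷ u) yxs⊆ys) ys≤xs)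
    where
    y∉xs′ : All (y ≢_) xs
    y∉xs′ = All.tabulate (λ { z∈ refl → y∉xs z∈ })
    yxs⊆ys : ∀ {x} → x ∈ y ∷ xs → x ∈ ys
    yxs⊆ys (here refl) = y∈ys
    yxs⊆ys (there x∈) = xs⊆ys x∈

  Unique-⊆-⊇⇒↭ : ∀ {xs ys : List A} → Unique xs → Unique ys →
                 (∀ {x} → x ∈ xs → x ∈ ys) → (∀ {y} → y ∈ ys → y ∈ xs) → xs ↭ ys
  Unique-⊆-⊇⇒↭ {[]} {[]} _ _ _ _ = ↭-refl
  Unique-⊆-⊇⇒↭ {[]} {y ∷ ys} _ _ _ ys⊆xs with ys⊆xs (here refl)
  ... | ()
  Unique-⊆-⊇⇒↭ {x ∷ xs} {ys} (x∉xs ∷ u) v xs⊆ys ys⊆xs =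
    ↭-trans (↭-prep x (Unique-⊆-⊇⇒↭ u (Unique-remove ys x∈ys v) xs⊆ys′ ys′⊆xs)) (↭-sym (remove-↭ ys x∈ys))
    where
    x∈ys = xs⊆ys (here refl)
    xs⊆ys′ : ∀ {z} → z ∈ xs → z ∈ remove ys x∈ys
    xs⊆ys′ z∈ = ∈-remove⁺ ys x∈ys (xs⊆ys (there z∈)) (λ { refl → All≢⇒∉ x∉xs z∈ })
    ys′⊆xs : ∀ {z} → z ∈ remove ys x∈ys → z ∈ xs
    ys′⊆xs z∈ with ys⊆xs (∈-remove⁻ ys x∈ys z∈)
    ... | here refl = ⊥-elim (∉-remove ys x∈ys v z∈)
    ... | there z∈xs = z∈xs

  count-≟ : ∀ (c : A) xs → Unique xs → c ∈ xs → count (λ x → does (x ≟ c)) xs ≡ 1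
  count-≟ c (y ∷ xs) (y∉xs ∷ _) (here refl) with y ≟ y
  ... | no y≢y = ⊥-elim (y≢y refl)
  ... | yes _ = cong suc (count-false _ xs (λ z z∈ → no-other z z∈))
    where
    no-other : ∀ z → z ∈ xs → does (z ≟ y) ≡ false
    no-other z z∈ with z ≟ y
    ... | yes refl = ⊥-elim (All≢⇒∉ y∉xs z∈)
    ... | no _ = refl
  count-≟ c (y ∷ xs) (y∉xs ∷ u) (there c∈) with y ≟ c
  ... | yes refl = ⊥-elim (All≢⇒∉ y∉xs c∈)
  ... | no _ = count-≟ c xs u c∈

-- Natural numbers, primes and the freshman's dream

m≤n⇒o≤n⇒m*o≡n*n⇒m≡n : ∀ {m n o} → m ≤ n → o ≤ n → m ℕ.* o ≡ n ℕ.* n → m ≡ n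
m≤n⇒o≤n⇒m*o≡n*n⇒m≡n {m} {n} {o} m≤n o≤n mo≡nn with ℕ.m≤n⇒m<n∨m≡n m≤n
... | inj₂ m≡n = m≡n
... | inj₁ m<n = ⊥-elim (ℕ.<-irrefl mo≡nn (ℕ.≤-<-trans (ℕ.*-monoʳ-≤ m o≤n) (ℕ.*-monoˡ-< n {{ℕ.>-nonZero (ℕ.≤-<-trans z≤n m<n)}} m<n)))

prime∤! : ∀ {p} → Prime p → ∀ m → m < p → ¬ p ∣ m !
prime∤! pp zero _ p∣1 with ∣1⇒≡1 p∣1
... | refl = ¬prime[1] pp
prime∤! pp (suc m) m<p p∣m! with euclidsLemma (suc m) (m !) pp p∣m!
... | inj₁ p∣1+m = ℕ.<⇒≱ m<p (∣⇒≤ p∣1+m)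
... | inj₂ p∣m! = prime∤! pp m (ℕ.<-trans (ℕ.n<1+n m) m<p) p∣m!

prime∣choose : ∀ {p} → Prime p → ∀ k → 0 < k → k < p → p ∣ p choose k
prime∣choose {zero} pp = ⊥-elim (¬prime[0] pp)
prime∣choose {p@(suc p′)} pp k 0<k k<p
  with euclidsLemma (p choose k) (k ! ℕ.* (p ℕ.∸ k) !) pp (subst (p ∣_) (sym choose*k!*[p-k]!≡p!) (m∣m*n (p′ !)))
  where
  instance _ = k ℕ.!* (p ℕ.∸ k) !≢0
  choose*k!*[p-k]!≡p! : (p choose k) ℕ.* (k ! ℕ.* (p ℕ.∸ k) !) ≡ p !
  choose*k!*[p-k]!≡p! = trans (cong (ℕ._* (k ! ℕ.* (p ℕ.∸ k) !)) (nCk≡n!/k![n-k]! (ℕ.<⇒≤ k<p))) (m/n*n≡m (k![n∸k]!∣n! (ℕ.<⇒≤ k<p)))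
... | inj₁ p∣C = p∣C
... | inj₂ p∣k!*[p-k]! with euclidsLemma (k !) ((p ℕ.∸ k) !) pp p∣k!*[p-k]!
...   | inj₁ p∣k! = ⊥-elim (prime∤! pp k k<p p∣k!)
...   | inj₂ p∣[p-k]! = ⊥-elim (prime∤! pp (p ℕ.∸ k) (ℕ.∸-monoʳ-< 0<k (ℕ.<⇒≤ k<p)) p∣[p-k]!)

module FreshmansDream {c ℓ} (R : CommutativeSemiring c ℓ) where

  open CommutativeSemiring R renaming (refl to ≈-refl; sym to ≈-sym; trans to ≈-trans)
  open import Algebra.Properties.Semiring.Exp semiring using (_^_; ^-assocʳ; ^-congˡ)
  open import Algebra.Properties.Semiring.Mult semiring using (×1-homo-*; ×-assoc-*; ×-congˡ; ×-congʳ) renaming (_×_ to _·_)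
  open import Algebra.Properties.Semiring.Sum semiring using (sum)
  open import Algebra.Properties.CommutativeSemiring.Binomial R using (theorem; binomialTerm)
  open import Relation.Binary.Reasoning.Setoid setoid

  private
    sum-only-last : ∀ n (t : Vector Carrier (suc n)) → (∀ k → toℕ k < n → t k ≈ 0#) → sum t ≈ t (fromℕ n)
    sum-only-last zero t _ = +-identityʳ _
    sum-only-last (suc n) t t≈0 = ≈-trans (+-cong (t≈0 Fin.zero (s≤s z≤n)) (sum-only-last n (λ k → t (Fin.suc k)) (λ k k<n → t≈0 (Fin.suc k) (s≤s k<n))))
                                        (+-identityˡ _)

  private
    multiple·≈0 : ∀ {p} → p · 1# ≈ 0# → ∀ t z → (t ℕ.* p) · z ≈ 0#
    multiple·≈0 {p} p·1≈0 t z = begin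
      (t ℕ.* p) · z                 ≈⟨ ×-congʳ (t ℕ.* p) (*-identityˡ z) ⟨
      (t ℕ.* p) · (1# * z)          ≈⟨ ×-assoc-* (t ℕ.* p) 1# z ⟨
      ((t ℕ.* p) · 1#) * z          ≈⟨ *-congʳ (×1-homo-* t p) ⟩
      ((t · 1#) * (p · 1#)) * z     ≈⟨ *-congʳ (*-congˡ p·1≈0) ⟩
      ((t · 1#) * 0#) * z           ≈⟨ *-congʳ (zeroʳ _) ⟩
      0# * z                        ≈⟨ zeroˡ z ⟩
      0#                            ∎

  freshman's-dream : ∀ {p} → Prime p → p · 1# ≈ 0# → ∀ x y → (x + y) ^ p ≈ x ^ p + y ^ p
  freshman's-dream {zero} pp _ = ⊥-elim (¬prime[0] pp)
  freshman's-dream {suc p′} pp p·1≈0 x y = begin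
    (x + y) ^ suc p′                                     ≈⟨ theorem (suc p′) x y ⟩
    term Fin.zero + sum (λ k → term (Fin.suc k))         ≈⟨ +-cong first (sum-only-last p′ _ middle) ⟩
    y ^ suc p′ + term (Fin.suc (fromℕ p′))               ≈⟨ +-congˡ last ⟩
    y ^ suc p′ + x ^ suc p′                              ≈⟨ +-comm _ _ ⟩
    x ^ suc p′ + y ^ suc p′                              ∎
    where
    term = binomialTerm x y (suc p′)
    first : term Fin.zero ≈ y ^ suc p′
    first = ≈-trans (+-identityʳ _) (*-identityˡ _)
    middle : ∀ k → toℕ k < p′ → term (Fin.suc k) ≈ 0#
    middle k k<p′ with prime∣choose pp (suc (toℕ k)) (s≤s z≤n) (s≤s k<p′)
    ... | divides t C≡t*p = ≈-trans (×-congˡ C≡t*p) (multiple·≈0 p·1≈0 t _)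
    last : term (Fin.suc (fromℕ p′)) ≈ x ^ suc p′
    last = begin
      (suc p′ choose suc (toℕ (fromℕ p′))) · (x ^ suc (toℕ (fromℕ p′)) * y ^ (p′ ℕ.∸ toℕ (fromℕ p′)))
        ≡⟨ cong (λ i → (suc p′ choose suc i) · (x ^ suc i * y ^ (p′ ℕ.∸ i))) (Fin.toℕ-fromℕ p′) ⟩
      (suc p′ choose suc p′) · (x ^ suc p′ * y ^ (p′ ℕ.∸ p′))
        ≡⟨ cong₂ (λ n i → n · (x ^ suc p′ * y ^ i)) (nCn≡1 (suc p′)) (ℕ.n∸n≡0 p′) ⟩
      1 · (x ^ suc p′ * 1#)                               ≈⟨ +-identityʳ _ ⟩
      x ^ suc p′ * 1#                                     ≈⟨ *-identityʳ _ ⟩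
      x ^ suc p′                                          ∎

  module _ {p : ℕ} (pp : Prime p) (p·1≈0 : p · 1# ≈ 0#) where

    freshman's-dream-^ : ∀ e x y → (x + y) ^ (p ℕ.^ e) ≈ x ^ (p ℕ.^ e) + y ^ (p ℕ.^ e)
    freshman's-dream-^ zero x y = ≈-trans (*-identityʳ _) (+-cong (≈-sym (*-identityʳ x)) (≈-sym (*-identityʳ y)))
    freshman's-dream-^ (suc e) x y = begin
      (x + y) ^ (p ℕ.* p ℕ.^ e)                   ≈⟨ ^-assocʳ (x + y) p (p ℕ.^ e) ⟨
      ((x + y) ^ p) ^ (p ℕ.^ e)                   ≈⟨ ^-congˡ (p ℕ.^ e) (freshman's-dream pp p·1≈0 x y) ⟩
      (x ^ p + y ^ p) ^ (p ℕ.^ e)                 ≈⟨ freshman's-dream-^ e (x ^ p) (y ^ p) ⟩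
      (x ^ p) ^ (p ℕ.^ e) + (y ^ p) ^ (p ℕ.^ e)   ≈⟨ +-cong (^-assocʳ x p _) (^-assocʳ y p _) ⟩
      x ^ (p ℕ.* p ℕ.^ e) + y ^ (p ℕ.* p ℕ.^ e)   ∎

-- The field GF(q²)

module FieldLemmas {q : ℕ} (G : FiniteField q) where

  open FiniteField G hiding (count)

  commutativeRing : CommutativeRing 0ℓ 0ℓ
  commutativeRing = record { isCommutativeRing = isCommutativeRing }

  open CommutativeRing commutativeRing public
    using ( +-comm; +-identityˡ; +-identityʳ; -‿inverseˡ; -‿inverseʳ; *-assoc; *-comm; *-identityˡ; *-identityʳ
          ; zeroˡ; zeroʳ; ring; semiring; +-isCommutativeMonoid; *-isCommutativeMonoid)
  open import Algebra.Properties.Ring ring public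
    using (-0#≈0#; -‿anti-homo-+; +-cancelˡ; +-cancelʳ; x∙y⁻¹≈ε⇒x≈y)
  open import Algebra.Properties.Semiring.Mult semiring using () renaming (_×_ to _·_)
  open IntegerCoefficientSolver commutativeRing public using (solve; _:=_; _:+_; _:*_; _:-_; :-_; con)
  open WithDecidableEquality _≟_ public
  open ≡-Reasoning

  x-y≡0⇒x≡y : ∀ {x y} → x - y ≡ 0# → x ≡ y
  x-y≡0⇒x≡y = x∙y⁻¹≈ε⇒x≈y _ _

  ==⇒≡ : ∀ {x y} → (x == y) ≡ true → x ≡ y
  ==⇒≡ {x} {y} x==y with x ≟ y
  ... | yes x≡y = x≡y

  ≡⇒== : ∀ {x y} → x ≡ y → (x == y) ≡ true
  ≡⇒== {x} {y} x≡y with x ≟ y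
  ... | yes _ = refl
  ... | no x≢y = ⊥-elim (x≢y x≡y)

  ≢⇒==false : ∀ {x y} → x ≢ y → (x == y) ≡ false
  ≢⇒==false {x} {y} x≢y with x ≟ y
  ... | yes x≡y = ⊥-elim (x≢y x≡y)
  ... | no _ = refl

  ==-cong : ∀ {x y x′ y′} → (x ≡ y → x′ ≡ y′) → (x′ ≡ y′ → x ≡ y) → (x == y) ≡ (x′ == y′)
  ==-cong {x} {y} {x′} {y′} to from with x ≟ y | x′ ≟ y′
  ... | yes _ | yes _ = refl
  ... | yes x≡y | no x′≢y′ = ⊥-elim (x′≢y′ (to x≡y))
  ... | no x≢y | yes x′≡y′ = ⊥-elim (x≢y (from x′≡y′))
  ... | no _ | no _ = refl

  ^-+ : ∀ x m n → x ^ (m ℕ.+ n) ≡ x ^ m * x ^ n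
  ^-+ x zero n = sym (*-identityˡ _)
  ^-+ x (suc m) n = trans (cong (x *_) (^-+ x m n)) (sym (*-assoc _ _ _))

  ^-* : ∀ x m n → x ^ (m ℕ.* n) ≡ (x ^ m) ^ n
  ^-* x m zero = cong (x ^_) (ℕ.*-zeroʳ m)
  ^-* x m (suc n) = trans (cong (x ^_) (ℕ.*-suc m n)) (trans (^-+ x m (m ℕ.* n)) (cong (x ^ m *_) (^-* x m n)))

  *-^ : ∀ x y n → (x * y) ^ n ≡ x ^ n * y ^ n
  *-^ x y zero = sym (*-identityˡ _)
  *-^ x y (suc n) = trans (cong ((x * y) *_) (*-^ x y n))
    (solve 4 (λ x y a b → (x :* y) :* (a :* b) := (x :* a) :* (y :* b)) refl x y _ _)

  1^ : ∀ n → 1# ^ n ≡ 1#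
  1^ zero = refl
  1^ (suc n) = trans (*-identityˡ _) (1^ n)

  x*y≡0⇒x≡0⊎y≡0 : ∀ {x y} → x * y ≡ 0# → x ≡ 0# ⊎ y ≡ 0#
  x*y≡0⇒x≡0⊎y≡0 {x} {y} xy≡0 with x ≟ 0#
  ... | yes x≡0 = inj₁ x≡0
  ... | no x≢0 = inj₂ (begin
    y                  ≡⟨ sym (*-identityˡ y) ⟩
    1# * y             ≡⟨ cong (_* y) (sym (⁻¹-inverse x x≢0)) ⟩
    (x * x ⁻¹) * y     ≡⟨ solve 3 (λ x i y → (x :* i) :* y := i :* (x :* y)) refl x (x ⁻¹) y ⟩
    x ⁻¹ * (x * y)     ≡⟨ cong (x ⁻¹ *_) xy≡0 ⟩
    x ⁻¹ * 0#          ≡⟨ zeroʳ _ ⟩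
    0#                 ∎)

  x*y≢0 : ∀ {x y} → x ≢ 0# → y ≢ 0# → x * y ≢ 0#
  x*y≢0 x≢0 y≢0 xy≡0 with x*y≡0⇒x≡0⊎y≡0 xy≡0
  ... | inj₁ x≡0 = x≢0 x≡0
  ... | inj₂ y≡0 = y≢0 y≡0

  x^n≢0 : ∀ {x} n → x ≢ 0# → x ^ n ≢ 0#
  x^n≢0 zero _ 1≡0 = 0≢1 (sym 1≡0)
  x^n≢0 (suc n) x≢0 = x*y≢0 x≢0 (x^n≢0 n x≢0)

  ⁻¹≢0 : ∀ {x} → x ≢ 0# → x ⁻¹ ≢ 0#
  ⁻¹≢0 {x} x≢0 x⁻¹≡0 = 0≢1 (trans (sym (zeroʳ x)) (trans (cong (x *_) (sym x⁻¹≡0)) (⁻¹-inverse x x≢0)))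

  x*[x⁻¹*y]≡y : ∀ {x} y → x ≢ 0# → x * (x ⁻¹ * y) ≡ y
  x*[x⁻¹*y]≡y {x} y x≢0 = trans (sym (*-assoc _ _ _)) (trans (cong (_* y) (⁻¹-inverse x x≢0)) (*-identityˡ y))

  *-cancelˡ : ∀ {x} y z → x ≢ 0# → x * y ≡ x * z → y ≡ z
  *-cancelˡ {x} y z x≢0 xy≡xz with x*y≡0⇒x≡0⊎y≡0 x[y-z]≡0
    where
    x[y-z]≡0 : x * (y - z) ≡ 0#
    x[y-z]≡0 = begin
      x * (y - z)         ≡⟨ solve 3 (λ x y z → x :* (y :- z) := x :* y :- x :* z) refl x y z ⟩
      x * y - x * z       ≡⟨ cong (_- x * z) xy≡xz ⟩
      x * z - x * z       ≡⟨ -‿inverseʳ _ ⟩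
      0#                  ∎
  ... | inj₁ x≡0 = ⊥-elim (x≢0 x≡0)
  ... | inj₂ y-z≡0 = x-y≡0⇒x≡y y-z≡0

  sumᴷ prodᴷ : List K → K
  sumᴷ = foldr _+_ 0#
  prodᴷ = foldr _*_ 1#

  sumᴷ-↭ : ∀ {xs ys} → xs ↭ ys → sumᴷ xs ≡ sumᴷ ys
  sumᴷ-↭ xs↭ys = PermutationSetoid.foldr-commMonoid (≡.setoid K) +-isCommutativeMonoid (↭⇒↭ₛ xs↭ys)

  prodᴷ-↭ : ∀ {xs ys} → xs ↭ ys → prodᴷ xs ≡ prodᴷ ys
  prodᴷ-↭ xs↭ys = PermutationSetoid.foldr-commMonoid (≡.setoid K) *-isCommutativeMonoid (↭⇒↭ₛ xs↭ys)

  sumᴷ-map-1+ : ∀ xs → sumᴷ (map (1# +_) xs) ≡ length xs · 1# + sumᴷ xs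
  sumᴷ-map-1+ [] = sym (+-identityˡ _)
  sumᴷ-map-1+ (x ∷ xs) = trans (cong ((1# + x) +_) (sumᴷ-map-1+ xs))
    (solve 4 (λ o x n s → (o :+ x) :+ (n :+ s) := (o :+ n) :+ (x :+ s)) refl 1# x _ _)

  prodᴷ-map-x* : ∀ x xs → prodᴷ (map (x *_) xs) ≡ x ^ length xs * prodᴷ xs
  prodᴷ-map-x* x [] = sym (*-identityˡ _)
  prodᴷ-map-x* x (y ∷ xs) = trans (cong ((x * y) *_) (prodᴷ-map-x* x xs))
    (solve 4 (λ x y a p → (x :* y) :* (a :* p) := (x :* a) :* (y :* p)) refl x y _ _)

  prodᴷ≢0 : ∀ xs → (∀ {x} → x ∈ xs → x ≢ 0#) → prodᴷ xs ≢ 0#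
  prodᴷ≢0 [] _ 1≡0 = 0≢1 (sym 1≡0)
  prodᴷ≢0 (x ∷ xs) xs≢0 = x*y≢0 (xs≢0 (here refl)) (prodᴷ≢0 xs (λ x∈ → xs≢0 (there x∈)))

  map-elems-↭ : ∀ (f : K → K) → (∀ {x y} → f x ≡ f y → x ≡ y) → (∀ y → Σ K λ x → f x ≡ y) → map f elems ↭ elems
  map-elems-↭ f f-inj f-onto = Unique-⊆-⊇⇒↭ (Unique-map⁺ f elems-unique (λ _ _ → f-inj)) elems-unique
    (λ _ → elems-complete _) (λ {y} _ → let x , fx≡y = f-onto y in subst (_∈ map f elems) fx≡y (∈-map⁺ f (elems-complete x)))

  [q*q]·1≡0 : (q ℕ.* q) · 1# ≡ 0#
  [q*q]·1≡0 = +-cancelʳ (sumᴷ elems) _ _ (begin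
    (q ℕ.* q) · 1# + sumᴷ elems           ≡⟨ cong (λ n → n · 1# + sumᴷ elems) (sym elems-size) ⟩
    length elems · 1# + sumᴷ elems        ≡⟨ sym (sumᴷ-map-1+ elems) ⟩
    sumᴷ (map (1# +_) elems)              ≡⟨ sumᴷ-↭ (map-elems-↭ (1# +_) 1+-injective (λ y → y - 1# , 1+[y-1]≡y y)) ⟩
    sumᴷ elems                            ≡⟨ sym (+-identityˡ _) ⟩
    0# + sumᴷ elems                       ∎)
    where
    1+-injective : ∀ {x y} → 1# + x ≡ 1# + y → x ≡ y
    1+-injective {x} {y} e = +-cancelʳ 1# x y (trans (+-comm x 1#) (trans e (+-comm 1# y)))
    1+[y-1]≡y : ∀ y → 1# + (y - 1#) ≡ y
    1+[y-1]≡y y = solve 2 (λ o y → o :+ (y :- o) := y) refl 1# y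

  nonzeros : List K
  nonzeros = filterᵇ (λ x → not (x == 0#)) elems

  ∈-nonzeros⁺ : ∀ {x} → x ≢ 0# → x ∈ nonzeros
  ∈-nonzeros⁺ {x} x≢0 = ∈-filterᵇ⁺ _ (elems-complete x) (cong not (≢⇒==false x≢0))

  ∈-nonzeros⁻ : ∀ {x} → x ∈ nonzeros → x ≢ 0#
  ∈-nonzeros⁻ {x} x∈ with ∈-filterᵇ⁻ (λ x → not (x == 0#)) {xs = elems} x∈
  ... | _ , x≢0 with x ≟ 0#
  ∈-nonzeros⁻ x∈ | _ , () | yes _
  ... | no x≢0 = x≢0

  1+|nonzeros|≡q*q : suc (length nonzeros) ≡ q ℕ.* q
  1+|nonzeros|≡q*q = begin
    suc (length nonzeros)                                   ≡⟨ cong (ℕ._+ length nonzeros) (sym (count-≟ 0# elems elems-unique (elems-complete 0#))) ⟩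
    count (_== 0#) elems ℕ.+ count (λ x → not (x == 0#)) elems ≡⟨ sym (length≡count+count-not (_== 0#) elems) ⟩
    length elems                                            ≡⟨ elems-size ⟩
    q ℕ.* q                                                 ∎

  -- Multiplication by x ≢ 0 permutes the nonzero elements, so their product P satisfies x ^ |K*| * P ≡ P.
  x^|K*|≡1 : ∀ {x} → x ≢ 0# → x ^ length nonzeros ≡ 1#
  x^|K*|≡1 {x} x≢0 = *-cancelˡ _ _ (prodᴷ≢0 nonzeros ∈-nonzeros⁻) (begin
    prodᴷ nonzeros * x ^ length nonzeros  ≡⟨ *-comm _ _ ⟩
    x ^ length nonzeros * prodᴷ nonzeros  ≡⟨ sym (prodᴷ-map-x* x nonzeros) ⟩
    prodᴷ (map (x *_) nonzeros)           ≡⟨ prodᴷ-↭ x*-permutes ⟩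
    prodᴷ nonzeros                        ≡⟨ sym (*-identityʳ _) ⟩
    prodᴷ nonzeros * 1#                   ∎)
    where
    x*-permutes : map (x *_) nonzeros ↭ nonzeros
    x*-permutes = Unique-⊆-⊇⇒↭
      (Unique-map⁺ (x *_) (Unique-filterᵇ _ elems-unique) (λ _ _ → *-cancelˡ _ _ x≢0))
      (Unique-filterᵇ _ elems-unique)
      (λ y∈ → let z , z∈ , y≡xz = ∈-map⁻ (x *_) y∈ in
               subst (_∈ nonzeros) (sym y≡xz) (∈-nonzeros⁺ (x*y≢0 x≢0 (∈-nonzeros⁻ z∈))))
      (λ {y} y∈ → subst (_∈ map (x *_) nonzeros) (x*[x⁻¹*y]≡y y x≢0)
                    (∈-map⁺ (x *_) (∈-nonzeros⁺ (x*y≢0 (⁻¹≢0 x≢0) (∈-nonzeros⁻ y∈)))))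

  x^[q*q]≡x : ∀ x → x ^ (q ℕ.* q) ≡ x
  x^[q*q]≡x x with x ≟ 0#
  ... | yes refl = subst (λ n → 0# ^ n ≡ 0#) 1+|nonzeros|≡q*q (zeroˡ _)
  ... | no x≢0 = subst (λ n → x ^ n ≡ x) 1+|nonzeros|≡q*q (trans (cong (x *_) (x^|K*|≡1 x≢0)) (*-identityʳ x))

  count-elems-bijection : ∀ (p : K → Bool) (f : K → K) → (∀ {x y} → f x ≡ f y → x ≡ y) → (∀ y → Σ K λ x → f x ≡ y) →
                          count (λ x → p (f x)) elems ≡ count p elems
  count-elems-bijection p f f-inj f-onto = trans (sym (count-map p f elems)) (count-↭ p (map-elems-↭ f f-inj f-onto))

  x+y==z≡x==z-y : ∀ x y z → ((x + y) == z) ≡ (x == z - y)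
  x+y==z≡x==z-y x y z = ==-cong (λ e → trans (solve 2 (λ x y → x := (x :+ y) :- y) refl x y) (cong (_- y) e))
                                (λ e → trans (cong (_+ y) e) (solve 2 (λ z y → (z :- y) :+ y := z) refl z y))

module Frobenius {q : ℕ} (G : FiniteField q) (q-primePower : IsPrimePower q) where

  open FiniteField G hiding (count)
  open FieldLemmas G
  open ≡-Reasoning
  open import Algebra.Properties.Semiring.Exp semiring using () renaming (_^_ to _^ᴱ_)
  open import Algebra.Properties.Semiring.Mult semiring using (×1-homo-*) renaming (_×_ to _·_)
  open FreshmansDream (CommutativeRing.commutativeSemiring commutativeRing) using (freshman's-dream-^)

  private
    p = proj₁ q-primePower
    e = proj₁ (proj₂ q-primePower)
    p-prime : Prime p
    p-prime = proj₁ (proj₂ (proj₂ q-primePower))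
    q≡p^e : q ≡ p ℕ.^ e
    q≡p^e = proj₂ (proj₂ (proj₂ (proj₂ q-primePower)))

    ^≡^ᴱ : ∀ x n → x ^ n ≡ x ^ᴱ n
    ^≡^ᴱ x zero = refl
    ^≡^ᴱ x (suc n) = cong (x *_) (^≡^ᴱ x n)

    ^·1≡·1^ : ∀ m n → (m ℕ.^ n) · 1# ≡ (m · 1#) ^ n
    ^·1≡·1^ m zero = +-identityʳ 1#
    ^·1≡·1^ m (suc n) = trans (×1-homo-* m (m ℕ.^ n)) (cong ((m · 1#) *_) (^·1≡·1^ m n))

  p·1≡0 : p · 1# ≡ 0#
  p·1≡0 with (p · 1#) ≟ 0#
  ... | yes p·1≡0 = p·1≡0
  ... | no p·1≢0 = ⊥-elim (x^n≢0 e p·1≢0 (trans (sym (^·1≡·1^ p e)) (trans (cong (_· 1#) (sym q≡p^e)) q·1≡0)))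
    where
    q·1≡0 : q · 1# ≡ 0#
    q·1≡0 with x*y≡0⇒x≡0⊎y≡0 (trans (sym (×1-homo-* q q)) [q*q]·1≡0)
    ... | inj₁ q·1≡0 = q·1≡0
    ... | inj₂ q·1≡0 = q·1≡0

  frob : K → K
  frob x = x ^ q

  frob-+ : ∀ x y → frob (x + y) ≡ frob x + frob y
  frob-+ x y = begin
    (x + y) ^ q                ≡⟨ ^≡^ᴱ (x + y) q ⟩
    (x + y) ^ᴱ q               ≡⟨ cong ((x + y) ^ᴱ_) q≡p^e ⟩
    (x + y) ^ᴱ (p ℕ.^ e)       ≡⟨ freshman's-dream-^ p-prime p·1≡0 e x y ⟩
    x ^ᴱ (p ℕ.^ e) + y ^ᴱ (p ℕ.^ e) ≡⟨ cong (λ n → x ^ᴱ n + y ^ᴱ n) (sym q≡p^e) ⟩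
    x ^ᴱ q + y ^ᴱ q            ≡⟨ sym (cong₂ _+_ (^≡^ᴱ x q) (^≡^ᴱ y q)) ⟩
    x ^ q + y ^ q              ∎

  frob-* : ∀ x y → frob (x * y) ≡ frob x * frob y
  frob-* x y = *-^ x y q

  frob-0 : frob 0# ≡ 0#
  frob-0 = +-cancelʳ (frob 0#) _ _ (trans (sym (frob-+ 0# 0#)) (trans (cong frob (+-identityˡ 0#)) (sym (+-identityˡ _))))

  frob-1 : frob 1# ≡ 1#
  frob-1 = 1^ q

  frob-neg : ∀ x → frob (- x) ≡ - frob x
  frob-neg x = +-cancelʳ (frob x) _ _ (begin
    frob (- x) + frob x     ≡⟨ sym (frob-+ (- x) x) ⟩
    frob (- x + x)          ≡⟨ cong frob (-‿inverseˡ x) ⟩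
    frob 0#                 ≡⟨ frob-0 ⟩
    0#                      ≡⟨ sym (-‿inverseˡ _) ⟩
    - frob x + frob x       ∎)

  frob-- : ∀ x y → frob (x - y) ≡ frob x - frob y
  frob-- x y = trans (frob-+ x (- y)) (cong (frob x +_) (frob-neg y))

  frob-involutive : ∀ x → frob (frob x) ≡ x
  frob-involutive x = trans (sym (^-* x q q)) (x^[q*q]≡x x)

  2≤q : 2 ≤ q
  2≤q = subst (2 ≤_) (sym q≡p^e) (2≤p^e p-prime (proj₁ (proj₂ (proj₂ (proj₂ q-primePower)))))
    where
    2≤p^e : ∀ {p e} → Prime p → 1 ≤ e → 2 ≤ p ℕ.^ e
    2≤p^e {zero} pp _ = ⊥-elim (¬prime[0] pp)
    2≤p^e {suc zero} pp _ = ⊥-elim (¬prime[1] pp)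
    2≤p^e {suc (suc p)} {suc e} _ _ = ℕ.≤-trans (s≤s (s≤s z≤n)) (ℕ.m≤m*n (suc (suc p)) (suc (suc p) ℕ.^ e) {{ℕ.m^n≢0 (suc (suc p)) e}})

  2∣q⇒1+1≡0 : 2 ∣ q → 1# + 1# ≡ 0#
  2∣q⇒1+1≡0 2∣q with prime⇒irreducible p-prime (2∣p^n⇒2∣p e (subst (2 ∣_) q≡p^e 2∣q))
    where
    2∣p^n⇒2∣p : ∀ n → 2 ∣ p ℕ.^ n → 2 ∣ p
    2∣p^n⇒2∣p zero 2∣1 with ∣1⇒≡1 2∣1
    ... | ()
    2∣p^n⇒2∣p (suc n) 2∣p^[1+n] with euclidsLemma p (p ℕ.^ n) prime[2] 2∣p^[1+n]
    ... | inj₁ 2∣p = 2∣p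
    ... | inj₂ 2∣p^n = 2∣p^n⇒2∣p n 2∣p^n
  ... | inj₁ ()
  ... | inj₂ refl = trans (cong (1# +_) (sym (+-identityʳ 1#))) p·1≡0

  nonsquare⇒≢0 : ∀ {x} → ¬ IsSquareInGFq x → x ≢ 0#
  nonsquare⇒≢0 ¬square refl = ¬square (0# , frob-0 , zeroˡ 0#)

module MonicPolynomials {q : ℕ} (G : FiniteField q) where

  open FiniteField G hiding (count)
  open FieldLemmas G
  open ≡-Reasoning

  -- evalMonic (c₀ ∷ … ∷ cₙ₋₁ ∷ []) x = c₀ + c₁ x + … + cₙ₋₁ xⁿ⁻¹ + xⁿ
  evalMonic : List K → K → K
  evalMonic [] x = 1#
  evalMonic (c ∷ cs) x = c + x * evalMonic cs x

  private
    quotient : K → List K → List K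
    quotient r [] = []
    quotient r (c ∷ []) = []
    quotient r (c ∷ c′ ∷ cs) = evalMonic (c′ ∷ cs) r ∷ quotient r (c′ ∷ cs)

    length-quotient : ∀ r c cs → length (quotient r (c ∷ cs)) ≡ length cs
    length-quotient r c [] = refl
    length-quotient r c (c′ ∷ cs) = cong suc (length-quotient r c′ cs)

    factor-theorem : ∀ r x c cs → evalMonic (c ∷ cs) x ≡ evalMonic (c ∷ cs) r + (x - r) * evalMonic (quotient r (c ∷ cs)) x
    factor-theorem r x c [] = solve 3 (λ c x r → c :+ x :* con (ℤ.+ 1) := (c :+ r :* con (ℤ.+ 1)) :+ (x :- r) :* con (ℤ.+ 1)) refl c x r
    factor-theorem r x c (c′ ∷ cs) = begin
      c + x * evalMonic (c′ ∷ cs) x       ≡⟨ cong (λ z → c + x * z) (factor-theorem r x c′ cs) ⟩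
      c + x * (P + (x - r) * Q)           ≡⟨ solve 5 (λ c x r P Q → c :+ x :* (P :+ (x :- r) :* Q) := (c :+ r :* P) :+ (x :- r) :* (P :+ x :* Q)) refl c x r P Q ⟩
      (c + r * P) + (x - r) * (P + x * Q) ∎
      where
      P = evalMonic (c′ ∷ cs) r
      Q = evalMonic (quotient r (c′ ∷ cs)) x

  |roots|≤degree : ∀ cs rs → Unique rs → (∀ {r} → r ∈ rs → evalMonic cs r ≡ 0#) → length rs ≤ length cs
  |roots|≤degree cs [] _ _ = z≤n
  |roots|≤degree [] (r ∷ rs) _ roots = ⊥-elim (0≢1 (sym (roots (here refl))))
  |roots|≤degree (c ∷ cs) (r ∷ rs) (r∉rs ∷ u) roots =
    s≤s (subst (length rs ≤_) (length-quotient r c cs) (|roots|≤degree (quotient r (c ∷ cs)) rs u quotient-roots))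
    where
    quotient-roots : ∀ {s} → s ∈ rs → evalMonic (quotient r (c ∷ cs)) s ≡ 0#
    quotient-roots {s} s∈ with x*y≡0⇒x≡0⊎y≡0 (begin
      (s - r) * evalMonic (quotient r (c ∷ cs)) s        ≡⟨ sym (+-identityˡ _) ⟩
      0# + (s - r) * evalMonic (quotient r (c ∷ cs)) s   ≡⟨ cong (_+ (s - r) * evalMonic (quotient r (c ∷ cs)) s) (sym (roots (here refl))) ⟩
      evalMonic (c ∷ cs) r + (s - r) * evalMonic (quotient r (c ∷ cs)) s ≡⟨ sym (factor-theorem r s c cs) ⟩
      evalMonic (c ∷ cs) s                               ≡⟨ roots (there s∈) ⟩
      0#                                                 ∎)
    ... | inj₂ Q[s]≡0 = Q[s]≡0
    ... | inj₁ s-r≡0 with x-y≡0⇒x≡y s-r≡0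
    ...   | refl = ⊥-elim (All≢⇒∉ r∉rs s∈)

module TraceZero {q : ℕ} (G : FiniteField q) (q-primePower : IsPrimePower q) where

  open FiniteField G hiding (count)
  open FieldLemmas G
  open Frobenius G q-primePower
  open MonicPolynomials G
  open ≡-Reasoning

  φ : K → K
  φ z = frob z - z

  φ-+ : ∀ x y → φ (x + y) ≡ φ x + φ y
  φ-+ x y = trans (cong (_- (x + y)) (frob-+ x y))
    (solve 4 (λ X Y x y → (X :+ Y) :- (x :+ y) := (X :- x) :+ (Y :- y)) refl (frob x) (frob y) x y)

  φ-- : ∀ x y → φ (x - y) ≡ φ x - φ y
  φ-- x y = trans (cong (_- (x - y)) (frob-- x y))
    (solve 4 (λ X Y x y → (X :- Y) :- (x :- y) := (X :- x) :- (Y :- y)) refl (frob x) (frob y) x y)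

  φ≡0⇒InGFq : ∀ {z} → φ z ≡ 0# → InGFq z
  φ≡0⇒InGFq = x-y≡0⇒x≡y

  InGFq⇒φ≡0 : ∀ {z} → InGFq z → φ z ≡ 0#
  InGFq⇒φ≡0 {z} z^q≡z = trans (cong (_- z) z^q≡z) (-‿inverseʳ z)

  Tr-+ : ∀ x y → Tr (x + y) ≡ Tr x + Tr y
  Tr-+ x y = trans (cong ((x + y) +_) (frob-+ x y))
    (solve 4 (λ x y X Y → (x :+ y) :+ (X :+ Y) := (x :+ X) :+ (y :+ Y)) refl x y (frob x) (frob y))

  Tr-neg : ∀ t → Tr (- t) ≡ - Tr t
  Tr-neg t = trans (cong (- t +_) (frob-neg t)) (solve 2 (λ t T → :- t :+ :- T := :- (t :+ T)) refl t (frob t))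

  Tr∘φ≡0 : ∀ z → Tr (φ z) ≡ 0#
  Tr∘φ≡0 z = begin
    φ z + frob (frob z - z)      ≡⟨ cong (φ z +_) (frob-- (frob z) z) ⟩
    φ z + (frob (frob z) - frob z) ≡⟨ cong (λ w → φ z + (w - frob z)) (frob-involutive z) ⟩
    (frob z - z) + (z - frob z)  ≡⟨ solve 2 (λ Z z → (Z :- z) :+ (z :- Z) := con (ℤ.+ 0)) refl (frob z) z ⟩
    0#                           ∎

  ∈T₀⁺ : ∀ {t} → Tr t ≡ 0# → t ∈ T₀
  ∈T₀⁺ {t} Tr[t]≡0 = ∈-filterᵇ⁺ _ (elems-complete t) (≡⇒== Tr[t]≡0)

  ∈T₀⁻ : ∀ {t} → t ∈ T₀ → Tr t ≡ 0#
  ∈T₀⁻ t∈ = ==⇒≡ (proj₂ (∈-filterᵇ⁻ (λ t → Tr t == 0#) {xs = elems} t∈))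

  0∈T₀ : 0# ∈ T₀
  0∈T₀ = ∈T₀⁺ (trans (+-identityˡ _) frob-0)

  T₀-+ : ∀ {s t} → s ∈ T₀ → t ∈ T₀ → s + t ∈ T₀
  T₀-+ {s} {t} s∈ t∈ = ∈T₀⁺ (trans (Tr-+ s t) (trans (cong₂ _+_ (∈T₀⁻ s∈) (∈T₀⁻ t∈)) (+-identityˡ 0#)))

  T₀-neg : ∀ {t} → t ∈ T₀ → - t ∈ T₀
  T₀-neg {t} t∈ = ∈T₀⁺ (trans (Tr-neg t) (trans (cong -_ (∈T₀⁻ t∈)) -0#≈0#))

  T₀-- : ∀ {s t} → s ∈ T₀ → t ∈ T₀ → s - t ∈ T₀
  T₀-- s∈ t∈ = T₀-+ s∈ (T₀-neg t∈)

  φ∈T₀ : ∀ z → φ z ∈ T₀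
  φ∈T₀ z = ∈T₀⁺ (Tr∘φ≡0 z)

  GFq : List K
  GFq = filterᵇ (λ x → frob x == x) elems

  ∈GFq⁺ : ∀ {x} → InGFq x → x ∈ GFq
  ∈GFq⁺ {x} x^q≡x = ∈-filterᵇ⁺ _ (elems-complete x) (≡⇒== x^q≡x)

  ∈GFq⁻ : ∀ {x} → x ∈ GFq → InGFq x
  ∈GFq⁻ x∈ = ==⇒≡ (proj₂ (∈-filterᵇ⁻ (λ x → frob x == x) {xs = elems} x∈))

  private
    x^q+s*x : K → List K
    x^q+s*x s = 0# ∷ s ∷ replicate (q ℕ.∸ 2) 0#

    degree-x^q+s*x : ∀ s → length (x^q+s*x s) ≡ q
    degree-x^q+s*x s = trans (cong (suc ∘ suc) (length-replicate (q ℕ.∸ 2))) (ℕ.m+[n∸m]≡n 2≤q)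

    evalMonic-replicate : ∀ n x → evalMonic (replicate n 0#) x ≡ x ^ n
    evalMonic-replicate zero x = refl
    evalMonic-replicate (suc n) x = trans (+-identityˡ _) (cong (x *_) (evalMonic-replicate n x))

    eval-x^q+s*x : ∀ s x → evalMonic (x^q+s*x s) x ≡ x ^ q + s * x
    eval-x^q+s*x s x = begin
      0# + x * (s + x * evalMonic (replicate (q ℕ.∸ 2) 0#) x) ≡⟨ cong (λ z → 0# + x * (s + x * z)) (evalMonic-replicate (q ℕ.∸ 2) x) ⟩
      0# + x * (s + x * x ^ (q ℕ.∸ 2))                       ≡⟨ solve 3 (λ x s X → con (ℤ.+ 0) :+ x :* (s :+ X) := x :* X :+ s :* x) refl x s (x * x ^ (q ℕ.∸ 2)) ⟩
      x ^ (2 ℕ.+ (q ℕ.∸ 2)) + s * x                         ≡⟨ cong (λ n → x ^ n + s * x) (ℕ.m+[n∸m]≡n 2≤q) ⟩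
      x ^ q + s * x                                          ∎

    at-most-q-roots : ∀ s {rs} → Unique rs → (∀ {r} → r ∈ rs → r ^ q + s * r ≡ 0#) → length rs ≤ q
    at-most-q-roots s u roots = subst (_ ≤_) (degree-x^q+s*x s)
      (|roots|≤degree (x^q+s*x s) _ u (λ r∈ → trans (eval-x^q+s*x s _) (roots r∈)))

  |GFq|≤q : length GFq ≤ q
  |GFq|≤q = at-most-q-roots (- 1#) (Unique-filterᵇ _ elems-unique) (λ {r} r∈ →
    trans (solve 2 (λ R r → R :+ (:- con (ℤ.+ 1)) :* r := R :- r) refl (r ^ q) r) (InGFq⇒φ≡0 (∈GFq⁻ r∈)))

  |T₀|≤q : length T₀ ≤ q
  |T₀|≤q = at-most-q-roots 1# (Unique-filterᵇ _ elems-unique) (λ {r} r∈ →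
    trans (solve 2 (λ R r → R :+ con (ℤ.+ 1) :* r := r :+ R) refl (r ^ q) r) (∈T₀⁻ r∈))

module Transversal {q : ℕ} (G : FiniteField q) (q-primePower : IsPrimePower q)
                   (C : FiniteField.K G → Bool) (C-transversal : FiniteField.IsTransversal G C) where

  open FiniteField G hiding (count)
  open FieldLemmas G
  open Frobenius G q-primePower
  open TraceZero G q-primePower
  open ≡-Reasoning

  private
    representative : ∀ x → Σ K λ c → C c ≡ true × InGFq (x - c)
    representative = proj₁ (proj₂ C-transversal)

    C-unique : ∀ c c′ → C c ≡ true → C c′ ≡ true → InGFq (c - c′) → c ≡ c′
    C-unique = proj₂ (proj₂ C-transversal)

  φ-injective-on-C : ∀ {c c′} → C c ≡ true → C c′ ≡ true → φ c ≡ φ c′ → c ≡ c′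
  φ-injective-on-C {c} {c′} Cc Cc′ φc≡φc′ =
    C-unique c c′ Cc Cc′ (φ≡0⇒InGFq (trans (φ-- c c′) (trans (cong (_- φ c′) φc≡φc′) (-‿inverseʳ _))))

  Cs : List K
  Cs = filterᵇ C elems

  ∈Cs⁺ : ∀ {c} → C c ≡ true → c ∈ Cs
  ∈Cs⁺ {c} Cc = ∈-filterᵇ⁺ C (elems-complete c) Cc

  ∈Cs⁻ : ∀ {c} → c ∈ Cs → C c ≡ true
  ∈Cs⁻ c∈ = proj₂ (∈-filterᵇ⁻ C {xs = elems} c∈)

  private
    +-injective-on-Cs×GFq : ∀ {c g c′ g′} → c ∈ Cs → g ∈ GFq → c′ ∈ Cs → g′ ∈ GFq → c + g ≡ c′ + g′ → (c , g) ≡ (c′ , g′)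
    +-injective-on-Cs×GFq {c} {g} {c′} {g′} c∈ g∈ c′∈ g′∈ c+g≡c′+g′ = cong₂ _,_ c≡c′ g≡g′
      where
      c≡c′ : c ≡ c′
      c≡c′ = φ-injective-on-C (∈Cs⁻ c∈) (∈Cs⁻ c′∈) (+-cancelʳ 0# _ _ (begin
        φ c + 0#          ≡⟨ cong (φ c +_) (sym (InGFq⇒φ≡0 (∈GFq⁻ g∈))) ⟩
        φ c + φ g         ≡⟨ sym (φ-+ c g) ⟩
        φ (c + g)         ≡⟨ cong φ c+g≡c′+g′ ⟩
        φ (c′ + g′)       ≡⟨ φ-+ c′ g′ ⟩
        φ c′ + φ g′       ≡⟨ cong (φ c′ +_) (InGFq⇒φ≡0 (∈GFq⁻ g′∈)) ⟩
        φ c′ + 0#         ∎))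
      g≡g′ : g ≡ g′
      g≡g′ = +-cancelˡ c g g′ (trans c+g≡c′+g′ (cong (_+ g′) (sym c≡c′)))

    sums : List K
    sums = map (uncurry _+_) (cartesianProduct Cs GFq)

    sums↭elems : sums ↭ elems
    sums↭elems = Unique-⊆-⊇⇒↭
      (Unique-map⁺ (uncurry _+_) (Unique.cartesianProduct⁺ (Unique-filterᵇ _ elems-unique) (Unique-filterᵇ _ elems-unique))
        (λ {(c , g)} {(c′ , g′)} cg∈ c′g′∈ →
          let c∈ , g∈ = ∈-cartesianProduct⁻ Cs GFq cg∈ ; c′∈ , g′∈ = ∈-cartesianProduct⁻ Cs GFq c′g′∈
          in +-injective-on-Cs×GFq c∈ g∈ c′∈ g′∈))
      elems-unique (λ _ → elems-complete _) x∈sums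
      where
      x∈sums : ∀ {x} → x ∈ elems → x ∈ sums
      x∈sums {x} _ with representative x
      ... | c , Cc , x-c∈GFq = subst (_∈ sums) (solve 2 (λ c x → c :+ (x :- c) := x) refl c x)
                                 (∈-map⁺ (uncurry _+_) (∈-cartesianProduct⁺ (∈Cs⁺ Cc) (∈GFq⁺ x-c∈GFq)))

  |Cs|*|GFq|≡q*q : length Cs ℕ.* length GFq ≡ q ℕ.* q
  |Cs|*|GFq|≡q*q = begin
    length Cs ℕ.* length GFq                   ≡⟨ sym (length-cartesianProductWith _,_ Cs GFq) ⟩
    length (cartesianProduct Cs GFq)           ≡⟨ sym (length-map (uncurry _+_) (cartesianProduct Cs GFq)) ⟩
    length sums                                ≡⟨ ↭-length sums↭elems ⟩
    length elems                               ≡⟨ elems-size ⟩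
    q ℕ.* q                                    ∎

  private
    φ[Cs]⊆T₀ : ∀ {t} → t ∈ map φ Cs → t ∈ T₀
    φ[Cs]⊆T₀ t∈ with ∈-map⁻ φ t∈
    ... | c , _ , refl = φ∈T₀ c

    Unique-φ[Cs] : Unique (map φ Cs)
    Unique-φ[Cs] = Unique-map⁺ φ (Unique-filterᵇ C elems-unique) (λ c∈ c′∈ → φ-injective-on-C (∈Cs⁻ c∈) (∈Cs⁻ c′∈))

    |Cs|≤|T₀| : length Cs ≤ length T₀
    |Cs|≤|T₀| = subst (_≤ length T₀) (length-map φ Cs) (Unique-⊆⇒length≤ Unique-φ[Cs] φ[Cs]⊆T₀)

  |Cs|≡q : length Cs ≡ q
  |Cs|≡q = m≤n⇒o≤n⇒m*o≡n*n⇒m≡n (ℕ.≤-trans |Cs|≤|T₀| |T₀|≤q) |GFq|≤q |Cs|*|GFq|≡q*q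

  |GFq|≡q : length GFq ≡ q
  |GFq|≡q = m≤n⇒o≤n⇒m*o≡n*n⇒m≡n |GFq|≤q (ℕ.≤-trans |Cs|≤|T₀| |T₀|≤q) (trans (ℕ.*-comm (length GFq) _) |Cs|*|GFq|≡q*q)

  |T₀|≡q : length T₀ ≡ q
  |T₀|≡q = ℕ.≤-antisym |T₀|≤q (subst (_≤ length T₀) |Cs|≡q |Cs|≤|T₀|)

  φ-onto-T₀ : ∀ {t} → t ∈ T₀ → Σ K λ c → C c ≡ true × φ c ≡ t
  φ-onto-T₀ t∈ =
    let c , c∈ , t≡φc = ∈-map⁻ φ (Unique-⊆-length≥⇒⊇ Unique-φ[Cs] φ[Cs]⊆T₀ |T₀|≤|φ[Cs]| t∈)
    in c , ∈Cs⁻ c∈ , sym t≡φc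
    where
    |T₀|≤|φ[Cs]| : length T₀ ≤ length (map φ Cs)
    |T₀|≤|φ[Cs]| = subst (length T₀ ≤_) (sym (trans (length-map φ Cs) |Cs|≡q)) |T₀|≤q

  count-C∧φ≡ : ∀ {t} → t ∈ T₀ → count (λ x → C x ∧ (φ x == t)) elems ≡ 1
  count-C∧φ≡ {t} t∈ = count-at (φ-onto-T₀ t∈)
    where
    count-at : (Σ K λ c → C c ≡ true × φ c ≡ t) → count (λ x → C x ∧ (φ x == t)) elems ≡ 1
    count-at (c , Cc , φc≡t) = trans (count-cong elems (λ x _ → C∧φ≡t⇔≡c x)) (count-≟ c elems elems-unique (elems-complete c))
      where
      C∧φ≡t⇔≡c : ∀ x → (C x ∧ (φ x == t)) ≡ (x == c)
      C∧φ≡t⇔≡c x with C x in Cx | x ≟ c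
      ... | true | yes refl = ≡⇒== φc≡t
      ... | true | no x≢c = ≢⇒==false (λ φx≡t → x≢c (φ-injective-on-C Cx Cc (trans φx≡t (sym φc≡t))))
      ... | false | yes refl with () ← trans (sym Cx) Cc
      ... | false | no _ = refl

  count-φ[w*]≡ : ∀ {w t} → w ≢ 0# → t ∈ T₀ → count (λ z → φ (w * z) == t) elems ≡ q
  count-φ[w*]≡ {w} {t} w≢0 t∈ = count-at (φ-onto-T₀ t∈)
    where
    count-at : (Σ K λ c → C c ≡ true × φ c ≡ t) → count (λ z → φ (w * z) == t) elems ≡ q
    count-at (c , _ , φc≡t) = begin
      count (λ z → φ (w * z) == t) elems        ≡⟨ count-elems-bijection (λ z → φ z == t) (w *_) (*-cancelˡ _ _ w≢0) (λ y → w ⁻¹ * y , x*[x⁻¹*y]≡y y w≢0) ⟩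
      count (λ z → φ z == t) elems              ≡⟨ sym (count-elems-bijection (λ z → φ z == t) (c +_) (+-cancelˡ c _ _) (λ y → y - c , c+[y-c]≡y y)) ⟩
      count (λ z → φ (c + z) == t) elems        ≡⟨ count-cong elems (λ z _ → ==-cong φ[c+z]≡t⇒InGFq InGFq⇒φ[c+z]≡t) ⟩
      count (λ z → frob z == z) elems           ≡⟨ |GFq|≡q ⟩
      q                                          ∎
      where
      c+[y-c]≡y : ∀ y → c + (y - c) ≡ y
      c+[y-c]≡y y = solve 2 (λ c y → c :+ (y :- c) := y) refl c y
      φ[c+z]≡t⇒InGFq : ∀ {z} → φ (c + z) ≡ t → InGFq z
      φ[c+z]≡t⇒InGFq {z} φ[c+z]≡t = φ≡0⇒InGFq (+-cancelˡ (φ c) _ _ (begin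
        φ c + φ z     ≡⟨ sym (φ-+ c z) ⟩
        φ (c + z)     ≡⟨ φ[c+z]≡t ⟩
        t             ≡⟨ sym φc≡t ⟩
        φ c           ≡⟨ sym (+-identityʳ _) ⟩
        φ c + 0#      ∎))
      InGFq⇒φ[c+z]≡t : ∀ {z} → InGFq z → φ (c + z) ≡ t
      InGFq⇒φ[c+z]≡t {z} z^q≡z = begin
        φ (c + z)     ≡⟨ φ-+ c z ⟩
        φ c + φ z     ≡⟨ cong (φ c +_) (InGFq⇒φ≡0 z^q≡z) ⟩
        φ c + 0#      ≡⟨ +-identityʳ _ ⟩
        φ c           ≡⟨ φc≡t ⟩
        t             ∎

-- Vectors over GF(q²)

module _ {A : Set} where

  lookup-∷ʳ-fromℕ : ∀ {m} (xs : Vec A m) x → lookup (xs ∷ʳ x) (fromℕ m) ≡ x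
  lookup-∷ʳ-fromℕ [] x = refl
  lookup-∷ʳ-fromℕ (_ ∷ xs) x = lookup-∷ʳ-fromℕ xs x

  lookup-∷ʳ-inject₁ : ∀ {m} (xs : Vec A m) x i → lookup (xs ∷ʳ x) (inject₁ i) ≡ lookup xs i
  lookup-∷ʳ-inject₁ (_ ∷ xs) x Fin.zero = refl
  lookup-∷ʳ-inject₁ (_ ∷ xs) x (Fin.suc i) = lookup-∷ʳ-inject₁ xs x i

module VectorSums {q : ℕ} (G : FiniteField q) where

  open FiniteField G hiding (count)
  open FieldLemmas G
  open import Algebra.Properties.Semiring.Sum semiring using (sum-cong-≗; sum-replicate-zero; ∑-distrib-+; *-distribˡ-sum)
  open ≡-Reasoning

  Unique-allVecs : ∀ m → Unique (allVecs m)
  Unique-allVecs zero = All.[] ∷ []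
  Unique-allVecs (suc m) = Unique.cartesianProductWith⁺ _∷_ Vec.∷-injective elems-unique (Unique-allVecs m)

  ∈-allVecs : ∀ {m} (v : Vec K m) → v ∈ allVecs m
  ∈-allVecs [] = here refl
  ∈-allVecs (x ∷ v) = ∈-cartesianProductWith⁺ _∷_ (elems-complete x) (∈-allVecs v)

  length-allVecs : ∀ m → length (allVecs m) ≡ (q ℕ.* q) ℕ.^ m
  length-allVecs zero = refl
  length-allVecs (suc m) = trans (length-cartesianProductWith _∷_ elems (allVecs m)) (cong₂ ℕ._*_ elems-size (length-allVecs m))

  count-allVecs-∷ : ∀ m (P : Vec K (suc m) → Bool) → count P (allVecs (suc m)) ≡ sumBy (λ x → count (λ v → P (x ∷ v)) (allVecs m)) elems
  count-allVecs-∷ m P = count-cartesianProductWith _∷_ P elems (allVecs m)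

  count-allVecs-∷ʳ : ∀ m (P : Vec K (suc m) → Bool) → count P (allVecs (suc m)) ≡ sumBy (λ v → count (λ x → P (v ∷ʳ x)) elems) (allVecs m)
  count-allVecs-∷ʳ zero P = begin
    count P (allVecs 1)                                       ≡⟨ count-allVecs-∷ zero P ⟩
    sumBy (λ x → count (λ v → P (x ∷ v)) ([] ∷ [])) elems      ≡⟨ sumBy-cong elems (λ x _ → count-[] (λ v → P (x ∷ v)) []) ⟩
    sumBy (λ x → if P (x ∷ []) then 1 else 0) elems            ≡⟨ sumBy-if (λ x → P (x ∷ [])) 1 elems ⟩
    count (λ x → P (x ∷ [])) elems ℕ.* 1                      ≡⟨ trans (ℕ.*-identityʳ _) (sym (ℕ.+-identityʳ _)) ⟩
    count (λ x → P (x ∷ [])) elems ℕ.+ 0                      ∎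
  count-allVecs-∷ʳ (suc m) P = begin
    count P (allVecs (suc (suc m)))
      ≡⟨ count-allVecs-∷ (suc m) P ⟩
    sumBy (λ x₀ → count (λ v → P (x₀ ∷ v)) (allVecs (suc m))) elems
      ≡⟨ sumBy-cong elems (λ x₀ _ → count-allVecs-∷ʳ m (λ v → P (x₀ ∷ v))) ⟩
    sumBy (λ x₀ → sumBy (λ v → count (λ x → P (x₀ ∷ (v ∷ʳ x))) elems) (allVecs m)) elems
      ≡⟨ sym (sumBy-cartesianProductWith _∷_ (λ v → count (λ x → P (v ∷ʳ x)) elems) elems (allVecs m)) ⟩
    sumBy (λ v → count (λ x → P (v ∷ʳ x)) elems) (allVecs (suc m)) ∎

  Σ-cong : ∀ {n} {f g : Fin n → K} → (∀ i → f i ≡ g i) → Σ[ f ] ≡ Σ[ g ]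
  Σ-cong = sum-cong-≗

  Σ-zero : ∀ {n} {f : Fin n → K} → (∀ i → f i ≡ 0#) → Σ[ f ] ≡ 0#
  Σ-zero {n} f≡0 = trans (sum-cong-≗ f≡0) (sum-replicate-zero n)

  Σ-neg : ∀ {n} (f : Fin n → K) → - Σ[ f ] ≡ Σ[ (λ i → - f i) ]
  Σ-neg {zero} f = -0#≈0#
  Σ-neg {suc n} f = trans (trans (-‿anti-homo-+ _ _) (+-comm _ _)) (cong (- f Fin.zero +_) (Σ-neg (λ i → f (Fin.suc i))))

  Σ-- : ∀ {n} (f g : Fin n → K) → Σ[ f ] - Σ[ g ] ≡ Σ[ (λ i → f i - g i) ]
  Σ-- f g = trans (cong (Σ[ f ] +_) (Σ-neg g)) (sym (∑-distrib-+ f (λ i → - g i)))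

  Σ-δ : ∀ {n} (v : Fin n → K) j → Σ[ (λ i → v i * (if does (i Fin.≟ j) then 1# else 0#)) ] ≡ v j
  Σ-δ {suc n} v Fin.zero = trans (cong₂ _+_ (*-identityʳ _) (Σ-zero (λ i → zeroʳ (v (Fin.suc i))))) (+-identityʳ _)
  Σ-δ {suc n} v (Fin.suc j) = trans (cong₂ _+_ (zeroʳ _) (Σ-δ (λ i → v (Fin.suc i)) j)) (+-identityˡ _)

  Σ-<ᵇ : ∀ m (h : Fin (suc m) → K) → Σ[ (λ i → if toℕ i <ᵇ m then h i else 0#) ] ≡ Σ[ (λ i → h (inject₁ i)) ]
  Σ-<ᵇ zero h = +-identityˡ 0#
  Σ-<ᵇ (suc m) h = cong (h Fin.zero +_) (Σ-<ᵇ m (λ i → h (Fin.suc i)))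

-- The array

module QuadraticForm {q : ℕ} (G : FiniteField q) (q-primePower : IsPrimePower q) (a b : FiniteField.K G) where

  open FiniteField G hiding (count)
  open FieldLemmas G
  open Frobenius G q-primePower
  open TraceZero G q-primePower
  open VectorSums G
  open import Algebra.Properties.Semiring.Sum semiring using (*-distribˡ-sum)
  open ≡-Reasoning

  c : K
  c = b ^ q - b

  Q : K → K
  Q u = a ^ q * u ^ (2 ℕ.* q) - a * u ^ 2 - c * u ^ (q ℕ.+ 1)

  ΣQ : ∀ {m} → Vec K m → Vec K m → K
  ΣQ α y = Σ[ (λ i → Q (lookup α i + lookup y i)) ]

  ΣQ₀ : ∀ {m} → Vec K m → K
  ΣQ₀ α = Σ[ (λ i → Q (lookup α i)) ]

  private
    Σ-Q : ∀ {n} (u : Fin n → K) →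
          a ^ q * Σ[ (λ i → u i ^ (2 ℕ.* q)) ] - a * Σ[ (λ i → u i ^ 2) ] - c * Σ[ (λ i → u i ^ (q ℕ.+ 1)) ] ≡ Σ[ (λ i → Q (u i)) ]
    Σ-Q {n} u = begin
      a ^ q * Σ[ f ] - a * Σ[ g ] - c * Σ[ h ]
        ≡⟨ cong₂ _-_ (cong₂ _-_ (*-distribˡ-sum (a ^ q) f) (*-distribˡ-sum a g)) (*-distribˡ-sum c h) ⟩
      Σ[ (λ i → a ^ q * f i) ] - Σ[ (λ i → a * g i) ] - Σ[ (λ i → c * h i) ]
        ≡⟨ cong (_- Σ[ (λ i → c * h i) ]) (Σ-- (λ i → a ^ q * f i) (λ i → a * g i)) ⟩
      Σ[ (λ i → a ^ q * f i - a * g i) ] - Σ[ (λ i → c * h i) ]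
        ≡⟨ Σ-- (λ i → a ^ q * f i - a * g i) (λ i → c * h i) ⟩
      Σ[ (λ i → Q (u i)) ] ∎
      where
      f g h : Fin n → K
      f i = u i ^ (2 ℕ.* q)
      g i = u i ^ 2
      h i = u i ^ (q ℕ.+ 1)

    -- The body of F with X₀ and Xₙ as parameters: F n a b X unfolds to F′ (X zero) (X (fromℕ n)) M₁ M₂ M₃.
    F′ : K → K → K → K → K → K
    F′ u w M₁ M₂ M₃ = (u ^ q) * (w ^ q) - w * (u ^ (2 ℕ.* q ℕ.∸ 1)) + (a ^ q) * M₁ - a * M₂ * (u ^ (2 ℕ.* q ℕ.∸ 2)) - c * M₃ * (u ^ (q ℕ.∸ 1))

    F′-at-1 : ∀ w M₁ M₂ M₃ → F′ 1# w M₁ M₂ M₃ ≡ φ w + (a ^ q * M₁ - a * M₂ - c * M₃)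
    F′-at-1 w M₁ M₂ M₃ = begin
      F′ 1# w M₁ M₂ M₃
        ≡⟨ cong₂ (λ s t → s * (w ^ q) - w * t + (a ^ q) * M₁ - a * M₂ * (1# ^ (2 ℕ.* q ℕ.∸ 2)) - c * M₃ * (1# ^ (q ℕ.∸ 1))) (1^ q) (1^ (2 ℕ.* q ℕ.∸ 1)) ⟩
      1# * (w ^ q) - w * 1# + (a ^ q) * M₁ - a * M₂ * (1# ^ (2 ℕ.* q ℕ.∸ 2)) - c * M₃ * (1# ^ (q ℕ.∸ 1))
        ≡⟨ cong₂ (λ s t → 1# * (w ^ q) - w * 1# + (a ^ q) * M₁ - a * M₂ * s - c * M₃ * t) (1^ (2 ℕ.* q ℕ.∸ 2)) (1^ (q ℕ.∸ 1)) ⟩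
      1# * (w ^ q) - w * 1# + (a ^ q) * M₁ - a * M₂ * 1# - c * M₃ * 1#
        ≡⟨ solve 8 (λ W w A a c M₁ M₂ M₃ → con (ℤ.+ 1) :* W :- w :* con (ℤ.+ 1) :+ A :* M₁ :- a :* M₂ :* con (ℤ.+ 1) :- c :* M₃ :* con (ℤ.+ 1)
                    := (W :- w) :+ (A :* M₁ :- a :* M₂ :- c :* M₃)) refl (w ^ q) w (a ^ q) a c M₁ M₂ M₃ ⟩
      φ w + (a ^ q * M₁ - a * M₂ - c * M₃) ∎

    module RowTimesM′ {n} (α v : Vec K n) where
      X : Fin (suc n) → K
      X = vecMat (lookup (1# ∷ v)) (matrixM′ α)

      X-zero : X Fin.zero ≡ 1#
      X-zero = trans (cong₂ _+_ (*-identityˡ 1#) (Σ-zero (λ i → zeroʳ (lookup v i)))) (+-identityʳ 1#)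

      X-suc : ∀ j → X (Fin.suc j) ≡ lookup α j + lookup v j
      X-suc j = cong₂ _+_ (*-identityˡ _) (Σ-δ (lookup v) j)

  Fᵍ-∷ʳ : ∀ {m} (α y : Vec K m) αₙ xₙ → Fᵍ (suc m) a b (α ∷ʳ αₙ) (1# ∷ (y ∷ʳ xₙ)) ≡ φ (αₙ + xₙ) + ΣQ α y
  Fᵍ-∷ʳ {m} α y αₙ xₙ = begin
    F′ (X Fin.zero) (X (fromℕ (suc m))) (M (λ x → x ^ (2 ℕ.* q))) (M (λ x → x ^ 2)) (M (λ x → x ^ (q ℕ.+ 1)))
      ≡⟨ cong₂ (λ u w → F′ u w (M (λ x → x ^ (2 ℕ.* q))) (M (λ x → x ^ 2)) (M (λ x → x ^ (q ℕ.+ 1)))) X-zero Xₙ≡αₙ+xₙ ⟩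
    F′ 1# (αₙ + xₙ) (M (λ x → x ^ (2 ℕ.* q))) (M (λ x → x ^ 2)) (M (λ x → x ^ (q ℕ.+ 1)))
      ≡⟨ F′-at-1 _ _ _ _ ⟩
    φ (αₙ + xₙ) + (a ^ q * M (λ x → x ^ (2 ℕ.* q)) - a * M (λ x → x ^ 2) - c * M (λ x → x ^ (q ℕ.+ 1)))
      ≡⟨ cong (φ (αₙ + xₙ) +_) (trans (cong₂ _-_ (cong₂ (λ s t → a ^ q * s - a * t) (M≡ (λ x → x ^ (2 ℕ.* q))) (M≡ (λ x → x ^ 2))) (cong (c *_) (M≡ (λ x → x ^ (q ℕ.+ 1))))) (Σ-Q (λ i → lookup α i + lookup y i))) ⟩
    φ (αₙ + xₙ) + ΣQ α y ∎
    where
    open RowTimesM′ (α ∷ʳ αₙ) (y ∷ʳ xₙ)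
    M : (K → K) → K
    M f = midSum (suc m) f X
    Xₙ≡αₙ+xₙ : X (fromℕ (suc m)) ≡ αₙ + xₙ
    Xₙ≡αₙ+xₙ = trans (X-suc (fromℕ m)) (cong₂ _+_ (lookup-∷ʳ-fromℕ α αₙ) (lookup-∷ʳ-fromℕ y xₙ))
    M≡ : ∀ f → M f ≡ Σ[ (λ i → f (lookup α i + lookup y i)) ]
    M≡ f = begin
      M f                                                              ≡⟨ +-identityˡ _ ⟩
      Σ[ (λ i → if toℕ i <ᵇ m then f (X (Fin.suc i)) else 0#) ]        ≡⟨ Σ-<ᵇ m (λ i → f (X (Fin.suc i))) ⟩
      Σ[ (λ i → f (X (Fin.suc (inject₁ i)))) ]                         ≡⟨ Σ-cong (λ i → cong f (X-suc-inject₁ i)) ⟩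
      Σ[ (λ i → f (lookup α i + lookup y i)) ]                         ∎
      where
      X-suc-inject₁ : ∀ i → X (Fin.suc (inject₁ i)) ≡ lookup α i + lookup y i
      X-suc-inject₁ i = trans (X-suc (inject₁ i)) (cong₂ _+_ (lookup-∷ʳ-inject₁ α αₙ i) (lookup-∷ʳ-inject₁ y xₙ i))

  private
    shift-== : ∀ x S₁ S₂ S₃ → ((x ^ q - x + a ^ q * S₁ - a * S₂) == c * S₃) ≡ (φ x == - (a ^ q * S₁ - a * S₂ - c * S₃))
    shift-== x S₁ S₂ S₃ = ==-cong
      (λ e → trans (solve 6 (λ X x A a S₁ S₂ → X :- x := ((X :- x) :+ A :* S₁ :- a :* S₂) :- A :* S₁ :+ a :* S₂) refl (x ^ q) x (a ^ q) a S₁ S₂)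
             (trans (cong (λ z → z - a ^ q * S₁ + a * S₂) e)
             (solve 6 (λ A a c S₁ S₂ S₃ → c :* S₃ :- A :* S₁ :+ a :* S₂ := :- (A :* S₁ :- a :* S₂ :- c :* S₃)) refl (a ^ q) a c S₁ S₂ S₃)))
      (λ e → trans (cong (λ z → z + a ^ q * S₁ - a * S₂) e)
             (solve 6 (λ A a c S₁ S₂ S₃ → (:- (A :* S₁ :- a :* S₂ :- c :* S₃)) :+ A :* S₁ :- a :* S₂ := c :* S₃) refl (a ^ q) a c S₁ S₂ S₃))

  colCond-∷ʳ : ∀ {m} (α : Vec K m) αₙ (C : K → Bool) → colCond (suc m) a b C (α ∷ʳ αₙ) ≡ (C αₙ ∧ (φ αₙ == - ΣQ₀ α))
  colCond-∷ʳ {m} α αₙ C = begin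
    C x ∧ ((x ^ q - x + a ^ q * S (λ u → u ^ (2 ℕ.* q)) - a * S (λ u → u ^ 2)) == c * S (λ u → u ^ (q ℕ.+ 1)))
      ≡⟨ cong (C x ∧_) (shift-== x _ _ _) ⟩
    C x ∧ (φ x == - (a ^ q * S (λ u → u ^ (2 ℕ.* q)) - a * S (λ u → u ^ 2) - c * S (λ u → u ^ (q ℕ.+ 1))))
      ≡⟨ cong₂ (λ y s → C y ∧ (φ y == - s)) (lookup-∷ʳ-fromℕ α αₙ)
               (trans (Σ-Q (λ i → lookup (α ∷ʳ αₙ) (inject₁ i))) (Σ-cong (λ i → cong Q (lookup-∷ʳ-inject₁ α αₙ i)))) ⟩
    C αₙ ∧ (φ αₙ == - ΣQ₀ α) ∎
    where
    x = lookup (α ∷ʳ αₙ) (fromℕ m)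
    S : (K → K) → K
    S f = Σ[ (λ i → f (lookup (α ∷ʳ αₙ) (inject₁ i))) ]

  two : K
  two = 1# + 1#

  private
    frob-c : frob c ≡ - c
    frob-c = trans (frob-- (frob b) b) (trans (cong (_- frob b) (frob-involutive b))
               (solve 2 (λ b B → b :- B := :- (B :- b)) refl b (frob b)))

    frob-two : frob two ≡ two
    frob-two = trans (frob-+ 1# 1#) (cong₂ _+_ frob-1 frob-1)

    u^2q : ∀ u → u ^ (2 ℕ.* q) ≡ frob u * frob u
    u^2q u = trans (^-+ u q (q ℕ.+ 0)) (cong (frob u *_) (cong (u ^_) (ℕ.+-identityʳ q)))

    u^[q+1] : ∀ u → u ^ (q ℕ.+ 1) ≡ frob u * u
    u^[q+1] u = trans (^-+ u q 1) (cong (frob u *_) (*-identityʳ u))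

  Q-frob : ∀ u → Q u ≡ frob a * (frob u * frob u) - a * (u * u) - c * (frob u * u)
  Q-frob u = trans (cong₂ (λ s t → frob a * s - a * t - c * (u ^ (q ℕ.+ 1))) (u^2q u) (cong (u *_) (*-identityʳ u)))
                   (cong (λ s → frob a * (frob u * frob u) - a * (u * u) - c * s) (u^[q+1] u))

  -- Frobenius swaps the first two terms of Q and negates the third, as frob c ≡ - c.
  Tr∘Q≡0 : ∀ u → Tr (Q u) ≡ 0#
  Tr∘Q≡0 u = begin
    Q u + frob (Q u)    ≡⟨ cong (λ z → z + frob z) (Q-frob u) ⟩
    E + frob E          ≡⟨ cong (E +_) frob-E ⟩
    E + (a * (u * u) - frob a * (frob u * frob u) - (- c) * (u * frob u))
      ≡⟨ solve 5 (λ A a c u U → (A :* (U :* U) :- a :* (u :* u) :- c :* (U :* u)) :+ (a :* (u :* u) :- A :* (U :* U) :- (:- c) :* (u :* U)) := con (ℤ.+ 0)) refl (frob a) a c u (frob u) ⟩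
    0#                  ∎
    where
    E = frob a * (frob u * frob u) - a * (u * u) - c * (frob u * u)
    frob-E : frob E ≡ a * (u * u) - frob a * (frob u * frob u) - (- c) * (u * frob u)
    frob-E = begin
      frob E
        ≡⟨ trans (frob-- _ _) (cong (_- frob (c * (frob u * u))) (frob-- _ _)) ⟩
      frob (frob a * (frob u * frob u)) - frob (a * (u * u)) - frob (c * (frob u * u))
        ≡⟨ cong₂ _-_ (cong₂ _-_ (trans (frob-* _ _) (cong₂ _*_ (frob-involutive a) (trans (frob-* _ _) (cong₂ _*_ (frob-involutive u) (frob-involutive u)))))
                                  (trans (frob-* _ _) (cong (frob a *_) (frob-* u u))))
                     (trans (frob-* _ _) (cong₂ _*_ frob-c (trans (frob-* _ _) (cong (_* frob u) (frob-involutive u))))) ⟩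
      a * (u * u) - frob a * (frob u * frob u) - (- c) * (u * frob u) ∎

  Q∈T₀ : ∀ u → Q u ∈ T₀
  Q∈T₀ u = ∈T₀⁺ (Tr∘Q≡0 u)

  Σ∈T₀ : ∀ {n} (f : Fin n → K) → (∀ i → f i ∈ T₀) → Σ[ f ] ∈ T₀
  Σ∈T₀ {zero} f _ = 0∈T₀
  Σ∈T₀ {suc n} f f∈T₀ = T₀-+ (f∈T₀ Fin.zero) (Σ∈T₀ (λ i → f (Fin.suc i)) (λ i → f∈T₀ (Fin.suc i)))

  ΣQ∈T₀ : ∀ {m} (α y : Vec K m) → ΣQ α y ∈ T₀
  ΣQ∈T₀ α y = Σ∈T₀ (λ i → Q (lookup α i + lookup y i)) (λ i → Q∈T₀ _)

  ΣQ₀∈T₀ : ∀ {m} (α : Vec K m) → ΣQ₀ α ∈ T₀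
  ΣQ₀∈T₀ α = Σ∈T₀ (λ i → Q (lookup α i)) (λ i → Q∈T₀ _)

  w : K → K
  w d = two * a * d + c * frob d

  frob-w : ∀ d → frob (w d) ≡ two * frob a * frob d - c * d
  frob-w d = trans (frob-+ _ _)
    (trans (cong₂ _+_ (trans (frob-* _ _) (cong (_* frob d) (trans (frob-* _ _) (cong (_* frob a) frob-two))))
                      (trans (frob-* _ _) (cong₂ _*_ frob-c (frob-involutive d))))
           (solve 3 (λ X c d → X :+ (:- c) :* d := X :- c :* d) refl (two * frob a * frob d) c d))

  -- Q is a quadratic form over GF(q) whose polar form is (d, y) ↦ φ (w d * y).
  Q-difference : ∀ α β y → Q (α + y) - Q (β + y) ≡ φ (w (α - β) * y) + (Q α - Q β)
  Q-difference α β y = begin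
    Q (α + y) - Q (β + y)
      ≡⟨ cong₂ _-_ (Q-frob (α + y)) (Q-frob (β + y)) ⟩
    (A * (frob (α + y) * frob (α + y)) - a * ((α + y) * (α + y)) - c * (frob (α + y) * (α + y)))
     - (A * (frob (β + y) * frob (β + y)) - a * ((β + y) * (β + y)) - c * (frob (β + y) * (β + y)))
      ≡⟨ cong₂ (λ s t → (A * (s * s) - a * ((α + y) * (α + y)) - c * (s * (α + y))) - (A * (t * t) - a * ((β + y) * (β + y)) - c * (t * (β + y)))) (frob-+ α y) (frob-+ β y) ⟩
    (A * ((Aα + Y) * (Aα + Y)) - a * ((α + y) * (α + y)) - c * ((Aα + Y) * (α + y)))
     - (A * ((Bβ + Y) * (Bβ + Y)) - a * ((β + y) * (β + y)) - c * ((Bβ + Y) * (β + y)))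
      ≡⟨ solve 9 (λ A a c α β y Aα Bβ Y →
            (A :* ((Aα :+ Y) :* (Aα :+ Y)) :- a :* ((α :+ y) :* (α :+ y)) :- c :* ((Aα :+ Y) :* (α :+ y)))
             :- (A :* ((Bβ :+ Y) :* (Bβ :+ Y)) :- a :* ((β :+ y) :* (β :+ y)) :- c :* ((Bβ :+ Y) :* (β :+ y)))
           := (((con (ℤ.+ 2) :* A :* (Aα :- Bβ) :- c :* (α :- β)) :* Y) :- (con (ℤ.+ 2) :* a :* (α :- β) :+ c :* (Aα :- Bβ)) :* y)
              :+ ((A :* (Aα :* Aα) :- a :* (α :* α) :- c :* (Aα :* α)) :- (A :* (Bβ :* Bβ) :- a :* (β :* β) :- c :* (Bβ :* β))))
          refl A a c α β y Aα Bβ Y ⟩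
    ((two * A * (Aα - Bβ) - c * (α - β)) * Y - (two * a * (α - β) + c * (Aα - Bβ)) * y)
      + ((A * (Aα * Aα) - a * (α * α) - c * (Aα * α)) - (A * (Bβ * Bβ) - a * (β * β) - c * (Bβ * β)))
      ≡⟨ cong₂ _+_ (sym φ[w*y]) (sym (cong₂ _-_ (Q-frob α) (Q-frob β))) ⟩
    φ (w (α - β) * y) + (Q α - Q β) ∎
    where
    A = frob a
    Aα = frob α
    Bβ = frob β
    Y = frob y
    φ[w*y] : φ (w (α - β) * y) ≡ (two * A * (Aα - Bβ) - c * (α - β)) * Y - (two * a * (α - β) + c * (Aα - Bβ)) * y
    φ[w*y] = cong₂ _-_ (trans (frob-* _ _) (cong (_* Y) (trans (frob-w (α - β)) (cong (λ z → two * A * z - c * (α - β)) (frob-- α β)))))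
                       (cong (λ z → (two * a * (α - β) + c * z) * y) (frob-- α β))

  -- If w d ≡ 0 then also frob (w d) ≡ 0, and eliminating frob d between the two
  -- equations leaves (4 a^(q+1) + c²) d^(q+1) ≡ 0.
  w-nondegenerate : four * a ^ (q ℕ.+ 1) + c ^ 2 ≢ 0# → ∀ {d} → w d ≡ 0# → d ≡ 0#
  w-nondegenerate disc≢0 {d} wd≡0 with x*y≡0⇒x≡0⊎y≡0 [disc]*d*frob[d]≡0
    where
    frob[w]≡0 : two * frob a * frob d - c * d ≡ 0#
    frob[w]≡0 = trans (sym (frob-w d)) (trans (cong frob wd≡0) frob-0)
    [disc]*d*frob[d]≡0 : (four * (frob a * a) + c * c) * (d * frob d) ≡ 0#
    [disc]*d*frob[d]≡0 = begin
      (four * (frob a * a) + c * c) * (d * frob d)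
        ≡⟨ solve 5 (λ A a c d D → ((con (ℤ.+ 1) :+ con (ℤ.+ 1) :+ con (ℤ.+ 1) :+ con (ℤ.+ 1)) :* (A :* a) :+ c :* c) :* (d :* D)
                 := (con (ℤ.+ 2) :* A :* D) :* (con (ℤ.+ 2) :* a :* d :+ c :* D) :- (c :* D) :* (con (ℤ.+ 2) :* A :* D :- c :* d)) refl (frob a) a c d (frob d) ⟩
      (two * frob a * frob d) * w d - (c * frob d) * (two * frob a * frob d - c * d)
        ≡⟨ cong₂ (λ s t → (two * frob a * frob d) * s - (c * frob d) * t) wd≡0 frob[w]≡0 ⟩
      (two * frob a * frob d) * 0# - (c * frob d) * 0#
        ≡⟨ solve 2 (λ x y → x :* con (ℤ.+ 0) :- y :* con (ℤ.+ 0) := con (ℤ.+ 0)) refl (two * frob a * frob d) (c * frob d) ⟩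
      0# ∎
  ... | inj₁ disc≡0 = ⊥-elim (disc≢0 (trans (cong₂ (λ s t → four * s + t) (u^[q+1] a) (cong (c *_) (*-identityʳ c))) disc≡0))
  ... | inj₂ d*frob[d]≡0 with x*y≡0⇒x≡0⊎y≡0 d*frob[d]≡0
  ...   | inj₁ d≡0 = d≡0
  ...   | inj₂ frob[d]≡0 = trans (sym (frob-involutive d)) (trans (cong frob frob[d]≡0) frob-0)


  b∉GFq⇒c≢0 : ¬ InGFq b → c ≢ 0#
  b∉GFq⇒c≢0 b∉GFq c≡0 = b∉GFq (x-y≡0⇒x≡y c≡0)

  char2⇒disc≢0 : 1# + 1# ≡ 0# → ¬ InGFq b → four * a ^ (q ℕ.+ 1) + c ^ 2 ≢ 0#
  char2⇒disc≢0 1+1≡0 b∉GFq disc≡0 with x*y≡0⇒x≡0⊎y≡0 c^2≡0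
    where
    four≡0 : four ≡ 0#
    four≡0 = trans (cong (λ z → z + 1# + 1#) 1+1≡0) (trans (cong (_+ 1#) (+-identityˡ 1#)) 1+1≡0)
    c^2≡0 : c * (c * 1#) ≡ 0#
    c^2≡0 = trans (sym (trans (cong (_+ c ^ 2) (trans (cong (_* a ^ (q ℕ.+ 1)) four≡0) (zeroˡ _))) (+-identityˡ _))) disc≡0
  ... | inj₁ c≡0 = b∉GFq⇒c≢0 b∉GFq c≡0
  ... | inj₂ c*1≡0 = b∉GFq⇒c≢0 b∉GFq (trans (sym (*-identityʳ c)) c*1≡0)

module OrthogonalArray {q : ℕ} (G : FiniteField q) (q-primePower : IsPrimePower q) (a b : FiniteField.K G)
                       (C : FiniteField.K G → Bool) (C-transversal : FiniteField.IsTransversal G C) where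

  open FiniteField G hiding (count)
  open FieldLemmas G
  open Frobenius G q-primePower
  open TraceZero G q-primePower
  open Transversal G q-primePower C C-transversal
  open VectorSums G
  open QuadraticForm G q-primePower a b
  open ≡-Reasoning

  private
    []≡[] : ∀ (u v : Vec K 0) → u ≡ v
    []≡[] [] [] = refl

    ∧-true : ∀ {x y} → (x ∧ y) ≡ true → x ≡ true × y ≡ true
    ∧-true {true} {true} _ = refl , refl

  ∈rowsW⁻ : ∀ {m x} → x ∈ rowsW (suc m) C → Σ (Vec K m) λ y → Σ K λ xₙ → C xₙ ≡ true × x ≡ 1# ∷ (y ∷ʳ xₙ)
  ∈rowsW⁻ {m} {x₀ ∷ v} x∈ with initLast v | ∧-true (proj₂ (∈-filterᵇ⁻ _ {xs = allVecs (suc (suc m))} x∈))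
  ... | y , xₙ , refl | x₀==1 , Cxₙ = y , xₙ , trans (sym (cong C (lookup-∷ʳ-fromℕ y xₙ))) Cxₙ , cong (_∷ (y ∷ʳ xₙ)) (==⇒≡ x₀==1)

  ∈colsR⁻ : ∀ {m α} → α ∈ colsR (suc m) a b C →
            Σ (Vec K m) λ α′ → Σ K λ αₙ → C αₙ ≡ true × φ αₙ ≡ - ΣQ₀ α′ × α ≡ α′ ∷ʳ αₙ
  ∈colsR⁻ {m} {α} α∈ with initLast α
  ... | α′ , αₙ , refl with ∧-true (trans (sym (colCond-∷ʳ α′ αₙ C)) (proj₂ (∈-filterᵇ⁻ (colCond (suc m) a b C) {xs = allVecs (suc m)} α∈)))
  ...   | Cαₙ , φαₙ== = α′ , αₙ , Cαₙ , ==⇒≡ φαₙ== , refl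

  completion : ∀ {m} (α : Vec K m) → Σ K λ αₙ → C αₙ ≡ true × φ αₙ ≡ - ΣQ₀ α
  completion α = φ-onto-T₀ (T₀-neg (ΣQ₀∈T₀ α))

  ∷ʳcompletion∈colsR : ∀ {m} (α : Vec K m) → α ∷ʳ proj₁ (completion α) ∈ colsR (suc m) a b C
  ∷ʳcompletion∈colsR {m} α = ∈-filterᵇ⁺ (colCond (suc m) a b C) (∈-allVecs _)
    (trans (colCond-∷ʳ α αₙ C) (cong₂ _∧_ (proj₁ (proj₂ (completion α))) (≡⇒== (proj₂ (proj₂ (completion α))))))
    where αₙ = proj₁ (completion α)

  count-rowsW : ∀ m (P : Vec K (suc (suc m)) → Bool) →
                count P (rowsW (suc m) C) ≡ sumBy (λ y → count (λ xₙ → C xₙ ∧ P (1# ∷ (y ∷ʳ xₙ))) elems) (allVecs m)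
  count-rowsW m P = begin
    count P (filterᵇ R (allVecs (suc (suc m))))
      ≡⟨ cong length (filterᵇ-filterᵇ P R (allVecs (suc (suc m)))) ⟩
    count (λ x → R x ∧ P x) (allVecs (suc (suc m)))
      ≡⟨ count-cong (allVecs (suc (suc m))) (λ x _ → ∧-assoc (lookup x Fin.zero == 1#) _ (P x)) ⟩
    count (λ x → (lookup x Fin.zero == 1#) ∧ (C (lookup x (fromℕ (suc m))) ∧ P x)) (allVecs (suc (suc m)))
      ≡⟨ count-allVecs-∷ (suc m) _ ⟩
    sumBy (λ x₀ → count (λ v → (x₀ == 1#) ∧ (C (lookup v (fromℕ m)) ∧ P (x₀ ∷ v))) (allVecs (suc m))) elems
      ≡⟨ sumBy-single (λ x₀ → count (λ v → (x₀ == 1#) ∧ (C (lookup v (fromℕ m)) ∧ P (x₀ ∷ v))) (allVecs (suc m))) 1# elems elems-unique (elems-complete 1#)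
                   (λ x₀ _ x₀≢1 → count-false _ (allVecs (suc m)) (λ v _ → cong (_∧ _) (≢⇒==false x₀≢1))) ⟩
    count (λ v → (1# == 1#) ∧ (C (lookup v (fromℕ m)) ∧ P (1# ∷ v))) (allVecs (suc m))
      ≡⟨ count-cong (allVecs (suc m)) (λ v _ → cong (_∧ _) (≡⇒== refl)) ⟩
    count (λ v → C (lookup v (fromℕ m)) ∧ P (1# ∷ v)) (allVecs (suc m))
      ≡⟨ count-allVecs-∷ʳ m _ ⟩
    sumBy (λ y → count (λ xₙ → C (lookup (y ∷ʳ xₙ) (fromℕ m)) ∧ P (1# ∷ (y ∷ʳ xₙ))) elems) (allVecs m)
      ≡⟨ sumBy-cong (allVecs m) (λ y _ → count-cong elems (λ xₙ _ → cong (λ z → C z ∧ P (1# ∷ (y ∷ʳ xₙ))) (lookup-∷ʳ-fromℕ y xₙ))) ⟩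
    sumBy (λ y → count (λ xₙ → C xₙ ∧ P (1# ∷ (y ∷ʳ xₙ))) elems) (allVecs m) ∎
    where
    R : Vec K (suc (suc m)) → Bool
    R x = (lookup x Fin.zero == 1#) ∧ C (lookup x (fromℕ (suc m)))

  |rowsW| : ∀ m → length (rowsW (suc m) C) ≡ (q ℕ.* q) ℕ.^ m ℕ.* q
  |rowsW| m = begin
    length (rowsW (suc m) C)                                     ≡⟨ sym (count-const true (rowsW (suc m) C)) ⟩
    count (λ _ → true) (rowsW (suc m) C)                         ≡⟨ count-rowsW m (λ _ → true) ⟩
    sumBy (λ y → count (λ xₙ → C xₙ ∧ true) elems) (allVecs m)   ≡⟨ sumBy-cong (allVecs m) (λ y _ → trans (count-cong elems (λ xₙ _ → ∧-identityʳ (C xₙ))) |Cs|≡q) ⟩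
    sumBy (λ y → q) (allVecs m)                                  ≡⟨ sumBy-const q (allVecs m) ⟩
    length (allVecs m) ℕ.* q                                     ≡⟨ cong (ℕ._* q) (length-allVecs m) ⟩
    (q ℕ.* q) ℕ.^ m ℕ.* q                                        ∎

  |colsR| : ∀ m → length (colsR (suc m) a b C) ≡ (q ℕ.* q) ℕ.^ m
  |colsR| m = begin
    count (colCond (suc m) a b C) (allVecs (suc m))
      ≡⟨ count-allVecs-∷ʳ m _ ⟩
    sumBy (λ α → count (λ αₙ → colCond (suc m) a b C (α ∷ʳ αₙ)) elems) (allVecs m)
      ≡⟨ sumBy-cong (allVecs m) (λ α _ → trans (count-cong elems (λ αₙ _ → colCond-∷ʳ α αₙ C)) (count-C∧φ≡ (T₀-neg (ΣQ₀∈T₀ α)))) ⟩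
    sumBy (λ _ → 1) (allVecs m)
      ≡⟨ trans (sumBy-const 1 (allVecs m)) (ℕ.*-identityʳ _) ⟩
    length (allVecs m)
      ≡⟨ length-allVecs m ⟩
    (q ℕ.* q) ℕ.^ m ∎

  entries∈T₀ : ∀ {m x α} → x ∈ rowsW (suc m) C → α ∈ colsR (suc m) a b C → Fᵍ (suc m) a b α x ∈ T₀
  entries∈T₀ x∈ α∈ with ∈rowsW⁻ x∈ | ∈colsR⁻ α∈
  ... | y , xₙ , _ , refl | α′ , αₙ , _ , _ , refl = subst (_∈ T₀) (sym (Fᵍ-∷ʳ α′ y αₙ xₙ)) (T₀-+ (φ∈T₀ _) (ΣQ∈T₀ α′ y))

  Δ : ∀ {k} → Vec K k → Vec K k → Vec K k → K
  Δ α β y = Σ[ (λ i → Q (lookup α i + lookup y i) - Q (lookup β i + lookup y i)) ]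

  module _ (disc≢0 : four * a ^ (q ℕ.+ 1) + c ^ 2 ≢ 0#) where

    count-Q-difference : ∀ {α₀ β₀ r} → α₀ ≢ β₀ → r ∈ T₀ → count (λ y → (Q (α₀ + y) - Q (β₀ + y)) == r) elems ≡ q
    count-Q-difference {α₀} {β₀} {r} α₀≢β₀ r∈ = begin
      count (λ y → (Q (α₀ + y) - Q (β₀ + y)) == r) elems
        ≡⟨ count-cong elems (λ y _ → trans (cong (_== r) (Q-difference α₀ β₀ y)) (x+y==z≡x==z-y _ _ r)) ⟩
      count (λ y → φ (w (α₀ - β₀) * y) == r - (Q α₀ - Q β₀)) elems
        ≡⟨ count-φ[w*]≡ w≢0 (T₀-- r∈ (T₀-- (Q∈T₀ α₀) (Q∈T₀ β₀))) ⟩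
      q ∎
      where
      w≢0 : w (α₀ - β₀) ≢ 0#
      w≢0 w≡0 = α₀≢β₀ (x-y≡0⇒x≡y (w-nondegenerate disc≢0 w≡0))

    count-Δ : ∀ {k} (α β : Vec K (suc k)) → α ≢ β → ∀ {r} → r ∈ T₀ → count (λ y → Δ α β y == r) (allVecs (suc k)) ≡ (q ℕ.* q) ℕ.^ k ℕ.* q
    count-Δ {k} (α₀ ∷ α) (β₀ ∷ β) α≢β {r} r∈ with Vec.≡-dec _≟_ α β
    ... | yes refl = begin
      count (λ y → Δ (α₀ ∷ α) (β₀ ∷ α) y == r) (allVecs (suc k))
        ≡⟨ count-allVecs-∷ k _ ⟩
      sumBy (λ y₀ → count (λ ys → (g y₀ + Δ α α ys) == r) (allVecs k)) elems
        ≡⟨ sumBy-cong elems (λ y₀ _ → trans (count-cong (allVecs k) (λ ys _ → cong (λ z → (g y₀ + z) == r) (Δ-diagonal ys)))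
                                            (count-const ((g y₀ + 0#) == r) (allVecs k))) ⟩
      sumBy (λ y₀ → if (g y₀ + 0#) == r then length (allVecs k) else 0) elems
        ≡⟨ sumBy-if (λ y₀ → (g y₀ + 0#) == r) (length (allVecs k)) elems ⟩
      count (λ y₀ → (g y₀ + 0#) == r) elems ℕ.* length (allVecs k)
        ≡⟨ cong₂ ℕ._*_ (trans (count-cong elems (λ y₀ _ → cong (_== r) (+-identityʳ (g y₀)))) (count-Q-difference α₀≢β₀ r∈)) (length-allVecs k) ⟩
      q ℕ.* (q ℕ.* q) ℕ.^ k
        ≡⟨ ℕ.*-comm q _ ⟩
      (q ℕ.* q) ℕ.^ k ℕ.* q ∎
      where
      g : K → K
      g y₀ = Q (α₀ + y₀) - Q (β₀ + y₀)
      α₀≢β₀ : α₀ ≢ β₀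
      α₀≢β₀ refl = α≢β refl
      Δ-diagonal : ∀ ys → Δ α α ys ≡ 0#
      Δ-diagonal ys = Σ-zero (λ i → -‿inverseʳ (Q (lookup α i + lookup ys i)))
    ... | no α≢β′ with k
    ...   | zero = ⊥-elim (α≢β′ ([]≡[] α β))
    ...   | suc k′ = begin
      count (λ y → Δ (α₀ ∷ α) (β₀ ∷ β) y == r) (allVecs (suc (suc k′)))
        ≡⟨ count-allVecs-∷ (suc k′) _ ⟩
      sumBy (λ y₀ → count (λ ys → (g y₀ + Δ α β ys) == r) (allVecs (suc k′))) elems
        ≡⟨ sumBy-cong elems (λ y₀ _ → trans (count-cong (allVecs (suc k′)) (λ ys _ → trans (cong (_== r) (+-comm (g y₀) (Δ α β ys))) (x+y==z≡x==z-y _ _ r)))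
                                            (count-Δ α β α≢β′ (T₀-- r∈ (T₀-- (Q∈T₀ _) (Q∈T₀ _))))) ⟩
      sumBy (λ _ → (q ℕ.* q) ℕ.^ k′ ℕ.* q) elems
        ≡⟨ sumBy-const _ elems ⟩
      length elems ℕ.* ((q ℕ.* q) ℕ.^ k′ ℕ.* q)
        ≡⟨ trans (cong (ℕ._* _) elems-size) (sym (ℕ.*-assoc (q ℕ.* q) _ q)) ⟩
      (q ℕ.* q) ℕ.^ suc k′ ℕ.* q ∎
      where
      g : K → K
      g y₀ = Q (α₀ + y₀) - Q (β₀ + y₀)

    private
      count-fibre-pair : ∀ A B s t → s - A ∈ T₀ →
        count (λ x → C x ∧ (((φ x + A) == s) ∧ ((φ x + B) == t))) elems ≡ (if (A - B) == (s - t) then 1 else 0)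
      count-fibre-pair A B s t s-A∈ with (A - B) ≟ (s - t)
      ... | yes A-B≡s-t = trans (count-cong elems (λ x _ → cong (C x ∧_) (both⇔first x))) (count-C∧φ≡ s-A∈)
        where
        both⇔first : ∀ x → (((φ x + A) == s) ∧ ((φ x + B) == t)) ≡ (φ x == s - A)
        both⇔first x = trans (cong₂ _∧_ (x+y==z≡x==z-y _ A s) (trans (x+y==z≡x==z-y _ B t) (cong (φ x ==_) t-B≡s-A))) (∧-idem _)
          where
          t-B≡s-A : t - B ≡ s - A
          t-B≡s-A = begin
            t - B                     ≡⟨ solve 4 (λ t B s A → t :- B := (s :- A) :+ ((A :- B) :- (s :- t))) refl t B s A ⟩
            (s - A) + ((A - B) - (s - t)) ≡⟨ cong (λ z → (s - A) + (z - (s - t))) A-B≡s-t ⟩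
            (s - A) + ((s - t) - (s - t)) ≡⟨ trans (cong ((s - A) +_) (-‿inverseʳ (s - t))) (+-identityʳ _) ⟩
            s - A                     ∎
      ... | no A-B≢s-t = count-false _ elems (λ x _ → neither x)
        where
        neither : ∀ x → (C x ∧ (((φ x + A) == s) ∧ ((φ x + B) == t))) ≡ false
        neither x with C x | (φ x + A) ≟ s | (φ x + B) ≟ t
        ... | false | _ | _ = refl
        ... | true | no _ | _ = refl
        ... | true | yes _ | no _ = refl
        ... | true | yes refl | yes refl = ⊥-elim (A-B≢s-t (solve 3 (λ f A B → A :- B := (f :+ A) :- (f :+ B)) refl (φ x) A B))

    balanced : ∀ k {α β} → α ∈ colsR (suc (suc k)) a b C → β ∈ colsR (suc (suc k)) a b C → α ≢ β →
               ∀ {s t} → s ∈ T₀ → t ∈ T₀ →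
               count (λ x → (Fᵍ (suc (suc k)) a b α x == s) ∧ (Fᵍ (suc (suc k)) a b β x == t)) (rowsW (suc (suc k)) C)
                 ≡ (q ℕ.* q) ℕ.^ k ℕ.* q
    balanced k α∈ β∈ α≢β {s} {t} s∈ t∈ with ∈colsR⁻ α∈ | ∈colsR⁻ β∈
    ... | α′ , αₙ , Cαₙ , φαₙ≡ , refl | β′ , βₙ , Cβₙ , φβₙ≡ , refl = begin
      count P (rowsW (suc (suc k)) C)
        ≡⟨ count-rowsW (suc k) P ⟩
      sumBy (λ y → count (λ xₙ → C xₙ ∧ P (1# ∷ (y ∷ʳ xₙ))) elems) (allVecs (suc k))
        ≡⟨ sumBy-cong (allVecs (suc k)) (λ y _ → trans (count-cong elems (λ xₙ _ → cong (C xₙ ∧_) (cong₂ _∧_ (entry α′ αₙ y xₙ s) (entry β′ βₙ y xₙ t))))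
                                                      (count-fibre-pair (A y) (B y) s t (T₀-- s∈ (T₀-+ (φ∈T₀ αₙ) (ΣQ∈T₀ α′ y))))) ⟩
      sumBy (λ y → if (A y - B y) == (s - t) then 1 else 0) (allVecs (suc k))
        ≡⟨ trans (sumBy-if _ 1 (allVecs (suc k))) (ℕ.*-identityʳ _) ⟩
      count (λ y → (A y - B y) == (s - t)) (allVecs (suc k))
        ≡⟨ count-cong (allVecs (suc k)) (λ y _ → A-B==s-t≡Δ==r₀ y) ⟩
      count (λ y → Δ α′ β′ y == r₀) (allVecs (suc k))
        ≡⟨ count-Δ α′ β′ α′≢β′ (T₀-- (T₀-- s∈ t∈) (T₀-- (φ∈T₀ αₙ) (φ∈T₀ βₙ))) ⟩
      (q ℕ.* q) ℕ.^ k ℕ.* q ∎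
      where
      P : Vec K (suc (suc (suc k))) → Bool
      P x = (Fᵍ (suc (suc k)) a b (α′ ∷ʳ αₙ) x == s) ∧ (Fᵍ (suc (suc k)) a b (β′ ∷ʳ βₙ) x == t)
      A B : Vec K (suc k) → K
      A y = φ αₙ + ΣQ α′ y
      B y = φ βₙ + ΣQ β′ y
      r₀ = (s - t) - (φ αₙ - φ βₙ)
      entry : ∀ γ γₙ y xₙ u → (Fᵍ (suc (suc k)) a b (γ ∷ʳ γₙ) (1# ∷ (y ∷ʳ xₙ)) == u) ≡ ((φ xₙ + (φ γₙ + ΣQ γ y)) == u)
      entry γ γₙ y xₙ u = cong (_== u) (trans (Fᵍ-∷ʳ γ y γₙ xₙ) (trans (cong (_+ ΣQ γ y) (φ-+ γₙ xₙ))
                            (solve 3 (λ G X S → (G :+ X) :+ S := X :+ (G :+ S)) refl (φ γₙ) (φ xₙ) (ΣQ γ y))))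
      A-B==s-t≡Δ==r₀ : ∀ y → ((A y - B y) == (s - t)) ≡ (Δ α′ β′ y == r₀)
      A-B==s-t≡Δ==r₀ y = trans (cong (_== (s - t)) (trans (solve 4 (λ u v S T → (u :+ S) :- (v :+ T) := (S :- T) :+ (u :- v)) refl (φ αₙ) (φ βₙ) (ΣQ α′ y) (ΣQ β′ y))
                                                           (cong (_+ (φ αₙ - φ βₙ)) (Σ-- (λ i → Q (lookup α′ i + lookup y i)) (λ i → Q (lookup β′ i + lookup y i))))))
                               (x+y==z≡x==z-y _ _ (s - t))
      α′≢β′ : α′ ≢ β′
      α′≢β′ refl = α≢β (cong (α′ ∷ʳ_) (φ-injective-on-C Cαₙ Cβₙ (trans φαₙ≡ (sym φβₙ≡))))

    module _ (b∉GFq : ¬ InGFq b) where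

      private
        -- If y₀ ≢ y₀′ then a₀ ↦ φ (w (y₀ - y₀′) * a₀) would be constant, hence zero, with
        -- w (y₀ - y₀′) ≢ 0; evaluating at a₀ = w (y₀ - y₀′) ⁻¹ * b gives φ b ≡ 0.
        Q-shift-constant⇒≡ : ∀ {y₀ y₀′ κ} → (∀ a₀ → Q (a₀ + y₀) - Q (a₀ + y₀′) ≡ κ) → y₀ ≡ y₀′
        Q-shift-constant⇒≡ {y₀} {y₀′} {κ} const with y₀ ≟ y₀′
        ... | yes y₀≡y₀′ = y₀≡y₀′
        ... | no y₀≢y₀′ = ⊥-elim (b∉GFq (φ≡0⇒InGFq (trans (cong φ (sym (x*[x⁻¹*y]≡y b W≢0))) (φ[W*]≡0 (W ⁻¹ * b)))))
          where
          W = w (y₀ - y₀′)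
          W≢0 : W ≢ 0#
          W≢0 W≡0 = y₀≢y₀′ (x-y≡0⇒x≡y (w-nondegenerate disc≢0 W≡0))
          K₀ = Q y₀ - Q y₀′
          φ[W*]+K₀≡κ : ∀ a₀ → φ (W * a₀) + K₀ ≡ κ
          φ[W*]+K₀≡κ a₀ = trans (sym (Q-difference y₀ y₀′ a₀)) (trans (cong₂ (λ u v → Q u - Q v) (+-comm y₀ a₀) (+-comm y₀′ a₀)) (const a₀))
          φ[W*0]≡0 : φ (W * 0#) ≡ 0#
          φ[W*0]≡0 = trans (cong φ (zeroʳ W)) (InGFq⇒φ≡0 frob-0)
          φ[W*]≡0 : ∀ a₀ → φ (W * a₀) ≡ 0#
          φ[W*]≡0 a₀ = +-cancelʳ K₀ _ _ (begin
            φ (W * a₀) + K₀    ≡⟨ φ[W*]+K₀≡κ a₀ ⟩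
            κ                  ≡⟨ sym (φ[W*]+K₀≡κ 0#) ⟩
            φ (W * 0#) + K₀    ≡⟨ cong (_+ K₀) φ[W*0]≡0 ⟩
            0# + K₀            ∎)

      ΣQ-shift-constant⇒≡ : ∀ {m} (y y′ : Vec K m) {κ} → (∀ α → ΣQ α y - ΣQ α y′ ≡ κ) → y ≡ y′
      ΣQ-shift-constant⇒≡ [] [] _ = refl
      ΣQ-shift-constant⇒≡ {suc m} (y₀ ∷ y) (y₀′ ∷ y′) {κ} const =
        cong₂ _∷_ (Q-shift-constant⇒≡ head-constant) (ΣQ-shift-constant⇒≡ y y′ tail-constant)
        where
        g : K → K
        g a₀ = Q (a₀ + y₀) - Q (a₀ + y₀′)
        zeros = Vec.replicate m 0#
        split : ∀ a₀ α → ΣQ (a₀ ∷ α) (y₀ ∷ y) - ΣQ (a₀ ∷ α) (y₀′ ∷ y′) ≡ g a₀ + (ΣQ α y - ΣQ α y′)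
        split a₀ α = solve 4 (λ A B C D → (A :+ B) :- (C :+ D) := (A :- C) :+ (B :- D)) refl (Q (a₀ + y₀)) (ΣQ α y) (Q (a₀ + y₀′)) (ΣQ α y′)
        head-constant : ∀ a₀ → g a₀ ≡ κ - (ΣQ zeros y - ΣQ zeros y′)
        head-constant a₀ = trans (solve 2 (λ g d → g := (g :+ d) :- d) refl (g a₀) (ΣQ zeros y - ΣQ zeros y′))
                                 (cong (_- (ΣQ zeros y - ΣQ zeros y′)) (trans (sym (split a₀ zeros)) (const (a₀ ∷ zeros))))
        tail-constant : ∀ α → ΣQ α y - ΣQ α y′ ≡ κ - g 0#
        tail-constant α = trans (solve 2 (λ g d → d := (g :+ d) :- g) refl (g 0#) (ΣQ α y - ΣQ α y′))
                                (cong (_- g 0#) (trans (sym (split 0# α)) (const (0# ∷ α))))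

      rows-separated : ∀ {m x x′} → x ∈ rowsW (suc m) C → x′ ∈ rowsW (suc m) C →
                       (∀ α → α ∈ colsR (suc m) a b C → Fᵍ (suc m) a b α x ≡ Fᵍ (suc m) a b α x′) → x ≡ x′
      rows-separated {m} x∈ x′∈ same with ∈rowsW⁻ x∈ | ∈rowsW⁻ x′∈
      ... | y , xₙ , Cxₙ , refl | y′ , xₙ′ , Cxₙ′ , refl = cong (λ v → 1# ∷ v) (cong₂ _∷ʳ_ y≡y′ xₙ≡xₙ′)
        where
        ΣQ-difference : ∀ α → ΣQ α y - ΣQ α y′ ≡ φ xₙ′ - φ xₙ
        ΣQ-difference α = begin
          ΣQ α y - ΣQ α y′
            ≡⟨ solve 5 (λ u X X′ S S′ → S :- S′ := ((u :+ X) :+ S :- (u :+ X)) :- ((u :+ X′) :+ S′ :- (u :+ X′))) refl U (φ xₙ) (φ xₙ′) (ΣQ α y) (ΣQ α y′) ⟩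
          ((U + φ xₙ) + ΣQ α y - (U + φ xₙ)) - ((U + φ xₙ′) + ΣQ α y′ - (U + φ xₙ′))
            ≡⟨ cong (λ z → (z - (U + φ xₙ)) - ((U + φ xₙ′) + ΣQ α y′ - (U + φ xₙ′))) entries-agree ⟩
          ((U + φ xₙ′) + ΣQ α y′ - (U + φ xₙ)) - ((U + φ xₙ′) + ΣQ α y′ - (U + φ xₙ′))
            ≡⟨ solve 4 (λ R u X X′ → (R :- (u :+ X)) :- (R :- (u :+ X′)) := X′ :- X) refl ((U + φ xₙ′) + ΣQ α y′) U (φ xₙ) (φ xₙ′) ⟩
          φ xₙ′ - φ xₙ ∎
          where
          αₙ = proj₁ (completion α)
          U = φ αₙ
          entries-agree : (U + φ xₙ) + ΣQ α y ≡ (U + φ xₙ′) + ΣQ α y′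
          entries-agree = begin
            (U + φ xₙ) + ΣQ α y                                 ≡⟨ cong (_+ ΣQ α y) (sym (φ-+ αₙ xₙ)) ⟩
            φ (αₙ + xₙ) + ΣQ α y                                ≡⟨ sym (Fᵍ-∷ʳ α y αₙ xₙ) ⟩
            Fᵍ (suc m) a b (α ∷ʳ αₙ) (1# ∷ (y ∷ʳ xₙ))           ≡⟨ same _ (∷ʳcompletion∈colsR α) ⟩
            Fᵍ (suc m) a b (α ∷ʳ αₙ) (1# ∷ (y′ ∷ʳ xₙ′))         ≡⟨ Fᵍ-∷ʳ α y′ αₙ xₙ′ ⟩
            φ (αₙ + xₙ′) + ΣQ α y′                              ≡⟨ cong (_+ ΣQ α y′) (φ-+ αₙ xₙ′) ⟩
            (U + φ xₙ′) + ΣQ α y′                               ∎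
        y≡y′ : y ≡ y′
        y≡y′ = ΣQ-shift-constant⇒≡ y y′ ΣQ-difference
        xₙ≡xₙ′ : xₙ ≡ xₙ′
        xₙ≡xₙ′ = φ-injective-on-C Cxₙ Cxₙ′ (sym (x-y≡0⇒x≡y (trans (sym (ΣQ-difference (Vec.replicate m 0#)))
                   (trans (cong (λ z → ΣQ (Vec.replicate m 0#) y - ΣQ (Vec.replicate m 0#) z) (sym y≡y′)) (-‿inverseʳ _)))))

module _ (q : ℕ) where

  open ≡-Reasoning

  [q*q]^m≡q^[2m] : ∀ m → (q ℕ.* q) ℕ.^ m ≡ q ℕ.^ (2 ℕ.* m)
  [q*q]^m≡q^[2m] m = trans (cong (λ r → (q ℕ.* r) ℕ.^ m) (sym (ℕ.*-identityʳ q))) (ℕ.^-*-assoc q 2 m)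

  [q*q]^m*q≡q^[1+2m] : ∀ m → (q ℕ.* q) ℕ.^ m ℕ.* q ≡ q ℕ.^ suc (2 ℕ.* m)
  [q*q]^m*q≡q^[1+2m] m = trans (ℕ.*-comm _ q) (cong (q ℕ.*_) ([q*q]^m≡q^[2m] m))

  rows-exponent : ∀ k → (q ℕ.* q) ℕ.^ suc k ℕ.* q ≡ q ℕ.^ (2 ℕ.* suc (suc k) ∸ 1)
  rows-exponent k = trans ([q*q]^m*q≡q^[1+2m] (suc k)) (cong (λ e → q ℕ.^ (e ∸ 1)) (sym (ℕ.*-suc 2 (suc k))))

  cols-exponent : ∀ k → (q ℕ.* q) ℕ.^ suc k ≡ q ℕ.^ (2 ℕ.* suc (suc k) ∸ 2)
  cols-exponent k = trans ([q*q]^m≡q^[2m] (suc k)) (cong (λ e → q ℕ.^ (e ∸ 2)) (sym (ℕ.*-suc 2 (suc k))))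

  index-exponent : ∀ k → (q ℕ.* q) ℕ.^ k ℕ.* q ≡ q ℕ.^ (2 ℕ.* suc (suc k) ∸ 3)
  index-exponent k = trans ([q*q]^m*q≡q^[1+2m] k)
    (cong (λ e → q ℕ.^ (e ∸ 1)) (trans (sym (ℕ.*-suc 2 k)) (cong (_∸ 2) (sym (ℕ.*-suc 2 (suc k))))))

  rows≡index*q² : ∀ k → q ℕ.^ (2 ℕ.* suc (suc k) ∸ 1) ≡ q ℕ.^ (2 ℕ.* suc (suc k) ∸ 3) ℕ.* (q ℕ.* q)
  rows≡index*q² k = begin
    q ℕ.^ (2 ℕ.* suc (suc k) ∸ 1)              ≡⟨ sym (rows-exponent k) ⟩
    (q ℕ.* q) ℕ.* (q ℕ.* q) ℕ.^ k ℕ.* q        ≡⟨ ℕ.*-assoc (q ℕ.* q) _ q ⟩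
    (q ℕ.* q) ℕ.* ((q ℕ.* q) ℕ.^ k ℕ.* q)      ≡⟨ ℕ.*-comm (q ℕ.* q) _ ⟩
    (q ℕ.* q) ℕ.^ k ℕ.* q ℕ.* (q ℕ.* q)        ≡⟨ cong (ℕ._* (q ℕ.* q)) (index-exponent k) ⟩
    q ℕ.^ (2 ℕ.* suc (suc k) ∸ 3) ℕ.* (q ℕ.* q) ∎

mainTheorem5 :
    (q : ℕ) → IsPrimePower q → (n : ℕ) → n ≥ 2 → (G : FiniteField q) →
    let open FiniteField G in
    (a b : K) → a ≢ 0# → ¬ InGFq b →
    ((¬ 2 ∣ n × ¬ 2 ∣ q × four * (a ^ (q Data.Nat.+ 1)) + ((b ^ q) - b) ^ 2 ≢ 0#)
     ⊎ (2 ∣ n × ¬ 2 ∣ q × ¬ IsSquareInGFq (four * (a ^ (q Data.Nat.+ 1)) + ((b ^ q) - b) ^ 2))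
     ⊎ (2 ∣ n × 2 ∣ q × Tr ((a ^ (q Data.Nat.+ 1)) / (((b ^ q) + b) ^ 2)) ≡ 0#)
     ⊎ (¬ 2 ∣ n × 2 ∣ q)) →
    (C : K → Bool) → IsTransversal C →
    IsOA₂ _≟_ (rowsW n C) (colsR n a b C) T₀ (λ x α → Fᵍ n a b α x)
          (q Data.Nat.^ (2 Data.Nat.* n ∸ 1)) (q Data.Nat.^ (2 Data.Nat.* n ∸ 2)) q
          (q Data.Nat.^ (2 Data.Nat.* n ∸ 3))
    × IsSimple (rowsW n C) (colsR n a b C) (λ x α → Fᵍ n a b α x)
mainTheorem5 q q-primePower (suc (suc k)) (s≤s (s≤s z≤n)) G a b _ b∉GFq hypotheses C C-transversal =
  record
    { rows-size = trans (|rowsW| (suc k)) (rows-exponent q k)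
    ; cols-size = trans (|colsR| (suc k)) (cols-exponent q k)
    ; syms-unique = Unique-filterᵇ _ elems-unique
    ; syms-size = |T₀|≡q
    ; entries = λ _ _ → entries∈T₀
    ; index = rows≡index*q² q k
    ; balanced = λ _ _ α∈ β∈ α≢β _ _ s∈ t∈ → trans (balanced disc≢0 k α∈ β∈ α≢β s∈ t∈) (index-exponent q k)
    }
  , Unique-filterᵇ _ (Unique-allVecs _)
  , (λ _ _ → rows-separated disc≢0 b∉GFq)
  where
  open FiniteField G hiding (count)
  open FieldLemmas G
  open Frobenius G q-primePower
  open VectorSums G
  open Transversal G q-primePower C C-transversal
  open QuadraticForm G q-primePower a b
  open OrthogonalArray G q-primePower a b C C-transversal
  disc≢0 : four * a ^ (q ℕ.+ 1) + c ^ 2 ≢ 0#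
  disc≢0 = [ (λ { (_ , _ , disc≢0) → disc≢0 })
           , [ (λ { (_ , _ , nonsquare) → nonsquare⇒≢0 nonsquare })
             , [ (λ { (_ , 2∣q , _) → char2⇒disc≢0 (2∣q⇒1+1≡0 2∣q) b∉GFq })
               , (λ { (_ , 2∣q) → char2⇒disc≢0 (2∣q⇒1+1≡0 2∣q) b∉GFq }) ]′ ]′ ]′ hypotheses
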